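{- Let $(G,t)$ be a non-trivial problem instance, $X$ a modulator of $G$, $C$ a connected component of $G-X$, $T$ a block-cut tree of $C$, and $B$ a block of $C$ whose only neighbour in $T$ is the articulation vertex $a$. Suppose $N_G(B-a)\setminus\{a\}$ is a limit-1 subset for $(G-V(B),t)$ and every $x\in N_G(B-a)\setminus\{a\}$ satisfies $\mathrm{tw}(G[V(B)\cup\{x\}]+ax)\le 2$ (the graph with edge $ax$ added). Let $G'$ be obtained from $G$ by contracting the connected subgraph $B$ into the single vertex $a$. Then $\mathrm{TW2D}(G)\le t$ if and only if $\mathrm{TW2D}(G')\le t$.
   Context: Graphs are finite, simple, undirected; $\mathrm{tw}$ is treewidth. A modulator of $G$ is $X\subseteq V(G)$ with $\mathrm{tw}(G-X)\le2$; $\mathrm{TW2D}(G)$ is its minimum size. A solution for $(H,t)$ is $S\subseteq V(H)$ with $|S|\le t$ and $\mathrm{tw}(H-S)\le2$; $W$ is a limit-1 subset for $(H,t)$ if every solution has $|W\setminus S|\le1$. An articulation vertex of $C$ is a vertex whose removal increases the number of components; a graph is biconnected if it has none; a block is a maximal biconnected subgraph. The block-cut tree of connected $C$ is the bipartite graph on the articulation vertices and blocks of $C$, with articulation vertex $a$ adjacent to block $B$ iff $a\in V(B)$. Contracting a connected subgraph into $a$ replaces it by a single vertex (called $a$) adjacent to all its outside neighbours. $N_G(H)$ is the set of vertices outside $V(H)$ adjacent to $H$. $(G,t)$ is trivial if $|V(G)|\le4$, or $\mathrm{tw}(G)\le2$, or $t=0$, or some nonempty connected subgraph $H$ has $G[N_G(H)\cup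 V(H)]$ plus all edges among $N_G(H)$ of treewidth at most 2; otherwise non-trivial. -}

module Defs where

open import Data.Nat using (ℕ; zero; suc; _≤_)
open import Data.Bool using (Bool; true; false; _∧_; _∨_; not)
open import Data.Fin using (Fin; zero; suc; toℕ; _≟_)
open import Data.Fin.Subset using (Subset; _∈_; _∉_; _⊆_; _∩_; _∪_; ∁; _─_; _-_; ⁅_⁆; ∣_∣; Nonempty)
import Data.Fin.Subset as Sub
open import Data.Vec using (lookup; tabulate)
open import Data.List using (allFin)
open import Data.Bool.ListAction using (any)
open import Data.Product using (Σ; ∃; _×_; _,_)
open import Data.Sum using (_⊎_)
open import Relation.Nullary using (¬_)
open import Relation.Nullary.Decidable using (⌊_⌋)
open import Relation.Binary.PropositionalEquality using (_≡_; _≢_)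

-- A graph lives inside the finite universe Fin n: it has a vertex set
-- V ⊆ Fin n and a Boolean "edge data" function E.  Adjacency is the
-- symmetric, irreflexive closure of E restricted to V, so every value
-- of this record is a finite simple undirected graph, and all graph
-- operations (deletion, induced subgraphs, adding edges, contraction)
-- stay inside the same universe Fin n.

record Graph (n : ℕ) : Set where
  constructor mkGraph
  field
    V : Subset n
    E : Fin n → Fin n → Bool
open Graph public

adjᵇ : ∀ {n} → Graph n → Fin n → Fin n → Bool
adjᵇ G u v = lookup (V G) u ∧ lookup (V G) v ∧ not ⌊ u ≟ v ⌋ ∧ (E G u v ∨ E G v u)

Adj : ∀ {n} → Graph n → Fin n → Fin n → Set
Adj G u v = adjᵇ G u v ≡ true

induced : ∀ {n} → Graph n → Subset n → Graph n
induced G S = mkGraph (V G ∩ S) (E G)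

delete : ∀ {n} → Graph n → Subset n → Graph n
delete G S = induced G (∁ S)

addClique : ∀ {n} → Graph n → Subset n → Graph n
addClique G W = mkGraph (V G) (λ u v → E G u v ∨ (lookup W u ∧ lookup W v))

addEdge : ∀ {n} → Graph n → Fin n → Fin n → Graph n
addEdge G x y = mkGraph (V G) (λ u v → E G u v ∨ (⌊ u ≟ x ⌋ ∧ ⌊ v ≟ y ⌋))

nbhd : ∀ {n} → Graph n → Subset n → Subset n
nbhd {n} G H = tabulate λ v →
  not (lookup H v) ∧ any (λ u → lookup H u ∧ adjᵇ G u v) (allFin n)

data Reach {n} (G : Graph n) : Fin n → Fin n → Set where
  here : ∀ {v} → v ∈ V G → Reach G v v
  step : ∀ {u w v} → Adj G u w → Reach G w v → Reach G u v

Connected : ∀ {n} → Graph n → Set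
Connected G = ∀ u v → u ∈ V G → v ∈ V G → Reach G u v

ConnectedSet : ∀ {n} → Graph n → Subset n → Set
ConnectedSet G S = Connected (induced G S)

IsComponent : ∀ {n} → Graph n → Subset n → Set
IsComponent G K = K ⊆ V G × Nonempty K × ConnectedSet G K ×
  (∀ K' → K ⊆ K' → K' ⊆ V G → ConnectedSet G K' → K' ⊆ K)

-- Blocks of a connected graph.
-- An articulation vertex of a connected graph H is a vertex whose removal
-- increases the number of components, i.e. (H being connected) H - v is
-- disconnected.
IsArticulation : ∀ {n} → Graph n → Fin n → Set
IsArticulation H a = a ∈ V H ×
  (∃ λ u → ∃ λ w → u ∈ V (delete H ⁅ a ⁆) × w ∈ V (delete H ⁅ a ⁆) ×
     ¬ Reach (delete H ⁅ a ⁆) u w)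

Biconnected : ∀ {n} → Graph n → Set
Biconnected H = Connected H × (∀ v → ¬ IsArticulation H v)

-- S is (the vertex set of) a block of H: a maximal biconnected subgraph
-- (maximal biconnected subgraphs are induced, so blocks are given by
-- their vertex sets).
IsBlock : ∀ {n} → Graph n → Subset n → Set
IsBlock H S = S ⊆ V H × Nonempty S × Biconnected (induced H S) ×
  (∀ S' → S ⊆ S' → S' ⊆ V H → Biconnected (induced H S') → S' ⊆ S)

-- In the block-cut tree of connected C, block B is adjacent exactly to the
-- articulation vertices of C lying in B.  "a is the only neighbour of B":
OnlyNeighbour : ∀ {n} → Graph n → Subset n → Fin n → Set
OnlyNeighbour C B a = (IsArticulation C a × a ∈ B) ×
  (∀ v → IsArticulation C v → v ∈ B → v ≡ a)

-- The decomposition tree has nodes Fin (suc m); node (suc i) is joined to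
-- its parent  parent i, whose index is at most i (every finite tree
-- admits such a labelling, and every such labelled graph is a tree).

treeGraph : ∀ {m} → (Fin m → Fin (suc m)) → Graph (suc m)
treeGraph {m} parent = mkGraph Sub.⊤ e
  where
  e : Fin (suc m) → Fin (suc m) → Bool
  e i zero    = false
  e i (suc p) = ⌊ parent p ≟ i ⌋

record TreeDecomposition {n} (k : ℕ) (G : Graph n) : Set where
  field
    m        : ℕ
    parent   : Fin m → Fin (suc m)
    parent<  : ∀ i → toℕ (parent i) ≤ toℕ i
    bag      : Fin (suc m) → Subset n
    bag⊆V    : ∀ i → bag i ⊆ V G
    width    : ∀ i → ∣ bag i ∣ ≤ suc k
    covers   : ∀ v → v ∈ V G → ∃ λ i → v ∈ bag i
    edges    : ∀ u v → Adj G u v → ∃ λ i → u ∈ bag i × v ∈ bag i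
    subtree  : ∀ v → ConnectedSet (treeGraph parent) (tabulate λ i → lookup (bag i) v)

TW≤ : ∀ {n} → ℕ → Graph n → Set
TW≤ k G = TreeDecomposition k G

IsModulator : ∀ {n} → Graph n → Subset n → Set
IsModulator G X = X ⊆ V G × TW≤ 2 (delete G X)

IsSolution : ∀ {n} → Graph n → ℕ → Subset n → Set
IsSolution H t S = S ⊆ V H × ∣ S ∣ ≤ t × TW≤ 2 (delete H S)

TW2D≤ : ∀ {n} → Graph n → ℕ → Set
TW2D≤ G t = ∃ λ X → IsModulator G X × ∣ X ∣ ≤ t

Limit1 : ∀ {n} → Graph n → ℕ → Subset n → Set
Limit1 H t W = ∀ S → IsSolution H t S → ∣ W ─ S ∣ ≤ 1

Trivial : ∀ {n} → Graph n → ℕ → Set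
Trivial G t = ∣ V G ∣ ≤ 4 ⊎ TW≤ 2 G ⊎ t ≡ 0 ⊎
  (∃ λ H → H ⊆ V G × Nonempty H × ConnectedSet G H ×
     TW≤ 2 (addClique (induced G (nbhd G H ∪ H)) (nbhd G H)))

NonTrivial : ∀ {n} → Graph n → ℕ → Set
NonTrivial G t = ¬ Trivial G t

contract : ∀ {n} → Graph n → Subset n → Fin n → Graph n
contract G B a = mkGraph (V G ─ (B - a)) e
  where
  e : _ → _ → Bool
  e u v = adjᵇ G u v ∨ (⌊ u ≟ a ⌋ ∧ lookup (nbhd G B) v)

module Submission where

-- A modulator Y of G yields one of G′ = G / B of no larger size: if Y meets B, replace Y ∩ B by a;
-- otherwise G′ − Y is G − Y with the connected set B contracted, and contraction keeps treewidth ≤ 2.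
-- Conversely, if Y is a modulator of G′ then Y − a solves (G − B, t), so by the limit-1 hypothesis at
-- most one vertex x of N(B − a) − a survives in G − Y.  Every edge of G − Y leaving B − a then ends in
-- B ∪ {x}, so G − Y is covered by G′ − Y and G[B ∪ {x}] + ax (just G[B] if no x survives), which overlap
-- only in the clique {a, x} minus Y.  Both have treewidth ≤ 2, and gluing their decompositions at
-- bags containing that clique gives a decomposition of G − Y.

open import Defs
open import Data.Nat as ℕ using (ℕ; zero; suc; _≤_; _<_; _⊔_; z≤n; s≤s; _+_)
import Data.Nat.Properties as ℕ
open import Data.Bool using (Bool; true; false; _∧_; _∨_; not)
open import Data.Bool.Properties using (∧-conicalˡ; ∧-conicalʳ)
open import Data.Bool.ListAction using (any)
open import Data.List as List using (allFin)
open import Data.List.Relation.Unary.Any using (here; there)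
open import Data.List.Membership.Propositional using () renaming (_∈_ to _∈ˡ_)
open import Data.List.Membership.Propositional.Properties using (∈-allFin)
open import Data.Fin using (Fin; zero; suc; toℕ; _≟_; punchIn; punchOut; splitAt; _↑ˡ_; _↑ʳ_)
import Data.Fin.Properties as Fin
open import Data.Fin.Subset using (Subset; _∈_; _∉_; _⊆_; _∩_; _∪_; ∁; _─_; _-_; ⁅_⁆; ∣_∣; Nonempty; ⊥)
open import Data.Fin.Subset.Properties
open import Data.Vec as Vec using (lookup; tabulate; []; _∷_)
open import Data.Vec.Properties using ([]=⇒lookup; lookup⇒[]=; lookup∘tabulate)
open import Data.Product as Product using (∃; _×_; _,_; proj₁; proj₂)
open import Data.Sum as Sum using (_⊎_; inj₁; inj₂; [_,_]′)
open import Data.Empty using (⊥-elim)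
open import Relation.Nullary using (¬_; yes; no; Dec)
open import Relation.Nullary.Decidable using (⌊_⌋)
open import Relation.Binary.PropositionalEquality using (_≡_; _≢_; refl; sym; trans; cong; subst; subst₂)
open import Function using (_∘_)
open import Function.Bundles using (_⇔_; mk⇔)

∧-intro : ∀ {a b} → a ≡ true → b ≡ true → a ∧ b ≡ true
∧-intro refl refl = refl

∨-introˡ : ∀ {a b} → a ≡ true → a ∨ b ≡ true
∨-introˡ refl = refl

∨-introʳ : ∀ {a b} → b ≡ true → a ∨ b ≡ true
∨-introʳ {true} _ = refl
∨-introʳ {false} p = p

∨-elim : ∀ {a b} → a ∨ b ≡ true → a ≡ true ⊎ b ≡ true
∨-elim {true} _ = inj₁ refl
∨-elim {false} p = inj₂ p

not≡true⇒≢true : ∀ {b} → not b ≡ true → b ≢ true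
not≡true⇒≢true {true} () refl

≢true⇒not≡true : ∀ {b} → b ≢ true → not b ≡ true
≢true⇒not≡true {true} b≢true = ⊥-elim (b≢true refl)
≢true⇒not≡true {false} _ = refl

does-true⇒≡ : ∀ {n} {u v : Fin n} → ⌊ u ≟ v ⌋ ≡ true → u ≡ v
does-true⇒≡ {u = u} {v} p with u ≟ v
... | yes u≡v = u≡v

≡⇒does-true : ∀ {n} {u v : Fin n} → u ≡ v → ⌊ u ≟ v ⌋ ≡ true
≡⇒does-true {u = u} {v} u≡v with u ≟ v
... | yes _ = refl
... | no u≢v = ⊥-elim (u≢v u≡v)

does-false⇒≢ : ∀ {n} {u v : Fin n} → not ⌊ u ≟ v ⌋ ≡ true → u ≢ v
does-false⇒≢ {u = u} {v} p with u ≟ v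
... | no u≢v = u≢v

≢⇒does-false : ∀ {n} {u v : Fin n} → u ≢ v → not ⌊ u ≟ v ⌋ ≡ true
≢⇒does-false {u = u} {v} u≢v with u ≟ v
... | yes u≡v = ⊥-elim (u≢v u≡v)
... | no _ = refl

any-witness : ∀ {A : Set} (f : A → Bool) xs → any f xs ≡ true → ∃ λ x → f x ≡ true
any-witness f (x List.∷ xs) p with ∨-elim {f x} p
... | inj₁ fx = x , fx
... | inj₂ rest = any-witness f xs rest

any-intro : ∀ {A : Set} (f : A → Bool) {xs x} → x ∈ˡ xs → f x ≡ true → any f xs ≡ true
any-intro f (here refl) fx = ∨-introˡ fx
any-intro f {y List.∷ _} (there x∈xs) fx = ∨-introʳ {f y} (any-intro f x∈xs fx)

lookup⇒∈ : ∀ {n} {p : Subset n} {x} → lookup p x ≡ true → x ∈ p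
lookup⇒∈ {p = p} {x} = lookup⇒[]= x p

∈⇒lookup : ∀ {n} {p : Subset n} {x} → x ∈ p → lookup p x ≡ true
∈⇒lookup = []=⇒lookup

∈-tabulate⁺ : ∀ {n} {f : Fin n → Bool} {x} → f x ≡ true → x ∈ tabulate f
∈-tabulate⁺ {f = f} {x} fx = lookup⇒∈ (trans (lookup∘tabulate f x) fx)

∈-tabulate⁻ : ∀ {n} {f : Fin n → Bool} {x} → x ∈ tabulate f → f x ≡ true
∈-tabulate⁻ {f = f} {x} x∈ = trans (sym (lookup∘tabulate f x)) (∈⇒lookup x∈)

x∈p─q⁻ : ∀ {n} {p q : Subset n} {x} → x ∈ p ─ q → x ∈ p × x ∉ q
x∈p─q⁻ {p = p} {q} x∈ = p─q⊆p p q x∈ , ∉q x∈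
  where
  ∉q : ∀ {n} {p q : Subset n} {x} → x ∈ p ─ q → x ∉ q
  ∉q {p = _ ∷ _} {true ∷ _} () Vec.here
  ∉q {p = _ ∷ _} {_ ∷ _} (Vec.there x∈) (Vec.there x∈q) = ∉q x∈ x∈q

∈∩⁺ : ∀ {n} {p q : Subset n} {x} → x ∈ p → x ∈ q → x ∈ p ∩ q
∈∩⁺ x∈p x∈q = x∈p∩q⁺ (x∈p , x∈q)

∈∩⁻ : ∀ {n} {p q : Subset n} {x} → x ∈ p ∩ q → x ∈ p × x ∈ q
∈∩⁻ {p = p} {q} = x∈p∩q⁻ p q

∈∩∁⁺ : ∀ {n} {p q : Subset n} {x} → x ∈ p → x ∉ q → x ∈ p ∩ ∁ q
∈∩∁⁺ x∈p x∉q = ∈∩⁺ x∈p (x∉p⇒x∈∁p x∉q)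

∈∩∁⁻ : ∀ {n} {p q : Subset n} {x} → x ∈ p ∩ ∁ q → x ∈ p × x ∉ q
∈∩∁⁻ x∈ = let x∈p , x∈∁q = ∈∩⁻ x∈ in x∈p , x∈∁p⇒x∉p x∈∁q

∣p∪q∣≤∣p∣+∣q∣ : ∀ {n} (p q : Subset n) → ∣ p ∪ q ∣ ≤ ∣ p ∣ + ∣ q ∣
∣p∪q∣≤∣p∣+∣q∣ [] [] = z≤n
∣p∪q∣≤∣p∣+∣q∣ (true ∷ p) (true ∷ q) = s≤s (ℕ.≤-trans (∣p∪q∣≤∣p∣+∣q∣ p q) (ℕ.+-monoʳ-≤ ∣ p ∣ (ℕ.n≤1+n _)))
∣p∪q∣≤∣p∣+∣q∣ (true ∷ p) (false ∷ q) = s≤s (∣p∪q∣≤∣p∣+∣q∣ p q)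
∣p∪q∣≤∣p∣+∣q∣ (false ∷ p) (true ∷ q) = subst (suc ∣ p ∪ q ∣ ≤_) (sym (ℕ.+-suc ∣ p ∣ ∣ q ∣)) (s≤s (∣p∪q∣≤∣p∣+∣q∣ p q))
∣p∪q∣≤∣p∣+∣q∣ (false ∷ p) (false ∷ q) = ∣p∪q∣≤∣p∣+∣q∣ p q

∣p─q∪⁅x⁆∣≤∣p∣ : ∀ {n} (p q : Subset n) x → Nonempty (p ∩ q) → ∣ (p ─ q) ∪ ⁅ x ⁆ ∣ ≤ ∣ p ∣
∣p─q∪⁅x⁆∣≤∣p∣ p q x meets = begin
  ∣ (p ─ q) ∪ ⁅ x ⁆ ∣    ≤⟨ ∣p∪q∣≤∣p∣+∣q∣ (p ─ q) ⁅ x ⁆ ⟩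
  ∣ p ─ q ∣ + ∣ ⁅ x ⁆ ∣  ≡⟨ cong (∣ p ─ q ∣ +_) (∣⁅x⁆∣≡1 x) ⟩
  ∣ p ─ q ∣ + 1          ≡⟨ ℕ.+-comm ∣ p ─ q ∣ 1 ⟩
  suc ∣ p ─ q ∣          ≤⟨ p∩q≢∅⇒∣p─q∣<∣p∣ p q meets ⟩
  ∣ p ∣                  ∎
  where open ℕ.≤-Reasoning

x∈p⇒1≤∣p∣ : ∀ {n} {p : Subset n} {x} → x ∈ p → 1 ≤ ∣ p ∣
x∈p⇒1≤∣p∣ {p = p} {x} x∈p =
  subst (_≤ ∣ p ∣) (∣⁅x⁆∣≡1 x) (p⊆q⇒∣p∣≤∣q∣ λ y∈ → subst (_∈ p) (sym (x∈⁅y⁆⇒x≡y x y∈)) x∈p)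

∣p∣≤1⇒≡ : ∀ {n} {p : Subset n} {x y} → ∣ p ∣ ≤ 1 → x ∈ p → y ∈ p → y ≡ x
∣p∣≤1⇒≡ {p = p} {x} {y} ∣p∣≤1 x∈p y∈p with y ≟ x
... | yes y≡x = y≡x
... | no y≢x = ⊥-elim (ℕ.<-irrefl refl (begin-strict
  1          ≤⟨ x∈p⇒1≤∣p∣ (x∈p∧x≢y⇒x∈p-y y∈p y≢x) ⟩
  ∣ p - x ∣  <⟨ x∈p⇒∣p-x∣<∣p∣ x∈p ⟩
  ∣ p ∣      ≤⟨ ∣p∣≤1 ⟩
  1          ∎))
  where open ℕ.≤-Reasoning

∣p∣≤2⇒≡⊎≡ : ∀ {n} {p : Subset n} {x y z} → ∣ p ∣ ≤ 2 → x ∈ p → y ∈ p → y ≢ x → z ∈ p → z ≡ x ⊎ z ≡ y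
∣p∣≤2⇒≡⊎≡ {x = x} {y} {z} ∣p∣≤2 x∈p y∈p y≢x z∈p with z ≟ x
... | yes z≡x = inj₁ z≡x
... | no z≢x = inj₂ (∣p∣≤1⇒≡ (ℕ.≤-pred (ℕ.<-≤-trans (x∈p⇒∣p-x∣<∣p∣ x∈p) ∣p∣≤2))
                       (x∈p∧x≢y⇒x∈p-y y∈p y≢x) (x∈p∧x≢y⇒x∈p-y z∈p z≢x))

record Adjacent {n} (G : Graph n) (u v : Fin n) : Set where
  constructor adjacent
  field
    src∈V : u ∈ V G
    tgt∈V : v ∈ V G
    src≢tgt : u ≢ v
    edge : E G u v ≡ true ⊎ E G v u ≡ true

Adj⇒Adjacent : ∀ {n} (G : Graph n) {u v} → Adj G u v → Adjacent G u v
Adj⇒Adjacent G {u} {v} p =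
  let p₁ = ∧-conicalʳ (lookup (V G) u) _ p
      p₂ = ∧-conicalʳ (lookup (V G) v) _ p₁
  in adjacent (lookup⇒∈ (∧-conicalˡ _ _ p)) (lookup⇒∈ (∧-conicalˡ _ _ p₁))
       (does-false⇒≢ (∧-conicalˡ (not ⌊ u ≟ v ⌋) _ p₂)) (∨-elim (∧-conicalʳ (not ⌊ u ≟ v ⌋) _ p₂))

Adjacent⇒Adj : ∀ {n} {G : Graph n} {u v} → Adjacent G u v → Adj G u v
Adjacent⇒Adj {G = G} (adjacent u∈ v∈ u≢v e) =
  ∧-intro {lookup (V G) _} (∈⇒lookup u∈)
    (∧-intro (∈⇒lookup v∈) (∧-intro (≢⇒does-false u≢v) ([ ∨-introˡ , ∨-introʳ ]′ e)))

Adj-sym : ∀ {n} (G : Graph n) {u v} → Adj G u v → Adj G v u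
Adj-sym G p with Adj⇒Adjacent G p
... | adjacent u∈ v∈ u≢v e = Adjacent⇒Adj (adjacent {G = G} v∈ u∈ (u≢v ∘ sym) ([ inj₂ , inj₁ ]′ e))

Adj⇒∈V : ∀ {n} (G : Graph n) {u v} → Adj G u v → u ∈ V G × v ∈ V G
Adj⇒∈V G p = let adjacent u∈ v∈ _ _ = Adj⇒Adjacent G p in u∈ , v∈

infix 4 _⊑_

record _⊑_ {n} (H K : Graph n) : Set where
  constructor subgraph
  field
    ⊑-V : V H ⊆ V K
    ⊑-Adj : ∀ {u v} → Adj H u v → Adj K u v
open _⊑_

⊑-trans : ∀ {n} {G H K : Graph n} → G ⊑ H → H ⊑ K → G ⊑ K
⊑-trans G⊑H H⊑K = subgraph (⊑-V H⊑K ∘ ⊑-V G⊑H) (⊑-Adj H⊑K ∘ ⊑-Adj G⊑H)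

induced-⊑ : ∀ {n} (G : Graph n) S → induced G S ⊑ G
induced-⊑ G S = subgraph (proj₁ ∘ ∈∩⁻) λ p →
  let adjacent u∈ v∈ u≢v e = Adj⇒Adjacent (induced G S) p
  in Adjacent⇒Adj (adjacent {G = G} (proj₁ (∈∩⁻ u∈)) (proj₁ (∈∩⁻ v∈)) u≢v e)

induced-Adj⁺ : ∀ {n} (G : Graph n) {S u v} → Adj G u v → u ∈ S → v ∈ S → Adj (induced G S) u v
induced-Adj⁺ G p u∈S v∈S =
  let adjacent u∈ v∈ u≢v e = Adj⇒Adjacent G p
  in Adjacent⇒Adj (adjacent {G = induced G _} (∈∩⁺ u∈ u∈S) (∈∩⁺ v∈ v∈S) u≢v e)

⊑-induced : ∀ {n} {H G : Graph n} {S} → H ⊑ G → V H ⊆ S → H ⊑ induced G S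
⊑-induced {H = H} {G} H⊑G VH⊆S = subgraph (λ x∈ → ∈∩⁺ (⊑-V H⊑G x∈) (VH⊆S x∈)) λ p →
  let u∈ , v∈ = Adj⇒∈V H p in induced-Adj⁺ G (⊑-Adj H⊑G p) (VH⊆S u∈) (VH⊆S v∈)

⊑-delete : ∀ {n} {H G : Graph n} {S} → H ⊑ G → (∀ {x} → x ∈ V H → x ∉ S) → H ⊑ delete G S
⊑-delete H⊑G disjoint = ⊑-induced H⊑G (x∉p⇒x∈∁p ∘ disjoint)

Reach-trans : ∀ {n} {G : Graph n} {u v w} → Reach G u v → Reach G v w → Reach G u w
Reach-trans (here _) r = r
Reach-trans (step p r) r′ = step p (Reach-trans r r′)

Reach-sym : ∀ {n} {G : Graph n} {u v} → Reach G u v → Reach G v u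
Reach-sym (here u∈) = here u∈
Reach-sym {G = G} (step p r) = Reach-trans (Reach-sym r) (step (Adj-sym G p) (here (proj₁ (Adj⇒∈V G p))))

Reach-map : ∀ {n k} {G : Graph n} {H : Graph k} (f : Fin n → Fin k) →
  (∀ {v} → v ∈ V G → f v ∈ V H) → (∀ {u v} → Adj G u v → Adj H (f u) (f v)) →
  ∀ {u v} → Reach G u v → Reach H (f u) (f v)
Reach-map f fV fAdj (here v∈) = here (fV v∈)
Reach-map f fV fAdj (step p r) = step (fAdj p) (Reach-map f fV fAdj r)

Reach-⊑ : ∀ {n} {H K : Graph n} → H ⊑ K → ∀ {u v} → Reach H u v → Reach K u v
Reach-⊑ H⊑K = Reach-map (λ x → x) (⊑-V H⊑K) (⊑-Adj H⊑K)

infixr 6 _∪ᴳ_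

_∪ᴳ_ : ∀ {n} → Graph n → Graph n → Graph n
G₁ ∪ᴳ G₂ = mkGraph (V G₁ ∪ V G₂) (λ u v → adjᵇ G₁ u v ∨ adjᵇ G₂ u v)

∪ᴳ-Adj⁻ : ∀ {n} (G₁ G₂ : Graph n) {u v} → Adj (G₁ ∪ᴳ G₂) u v → Adj G₁ u v ⊎ Adj G₂ u v
∪ᴳ-Adj⁻ G₁ G₂ {u} {v} a with Adjacent.edge (Adj⇒Adjacent (G₁ ∪ᴳ G₂) {u} {v} a)
... | inj₁ e = ∨-elim {adjᵇ G₁ u v} e
... | inj₂ e = Sum.map (Adj-sym G₁ {v} {u}) (Adj-sym G₂ {v} {u}) (∨-elim {adjᵇ G₁ v u} e)

⊑-∪ᴳ : ∀ {n} {H G₁ G₂ : Graph n} → (∀ {v} → v ∈ V H → v ∈ V G₁ ⊎ v ∈ V G₂) →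
  (∀ u v → Adj H u v → Adj G₁ u v ⊎ Adj G₂ u v) → H ⊑ G₁ ∪ᴳ G₂
⊑-∪ᴳ {H = H} {G₁} {G₂} cover-V cover-Adj = subgraph (x∈p∪q⁺ ∘ cover-V) λ {u} {v} a →
  let u∈ , v∈ = Adj⇒∈V H {u} {v} a
  in Adjacent⇒Adj {G = G₁ ∪ᴳ G₂} (adjacent (x∈p∪q⁺ (cover-V u∈)) (x∈p∪q⁺ (cover-V v∈))
       (Adjacent.src≢tgt (Adj⇒Adjacent H {u} {v} a))
       (inj₁ ([ ∨-introˡ , ∨-introʳ {adjᵇ G₁ u v} ]′ (cover-Adj u v a))))

module _ {n} (G : Graph n) (S : Subset n) where

  private
    outsideNeighbour : Fin n → Bool
    outsideNeighbour v = not (lookup S v) ∧ any (λ u → lookup S u ∧ adjᵇ G u v) (allFin n)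

  nbhd⁻ : ∀ {v} → v ∈ nbhd G S → v ∉ S × ∃ λ u → u ∈ S × Adj G u v
  nbhd⁻ {v} v∈ =
    let e = trans (sym (lookup∘tabulate outsideNeighbour v)) (∈⇒lookup v∈)
        u , hit = any-witness (λ u → lookup S u ∧ adjᵇ G u v) (allFin n) (∧-conicalʳ (not (lookup S v)) _ e)
    in not≡true⇒≢true (∧-conicalˡ _ _ e) ∘ ∈⇒lookup , u , lookup⇒∈ (∧-conicalˡ _ _ hit) , ∧-conicalʳ (lookup S u) _ hit

  nbhd⁺ : ∀ {u v} → v ∉ S → u ∈ S → Adj G u v → v ∈ nbhd G S
  nbhd⁺ {u} {v} v∉S u∈S a = lookup⇒∈ (trans (lookup∘tabulate outsideNeighbour v)
    (∧-intro (≢true⇒not≡true (v∉S ∘ lookup⇒∈))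
      (any-intro (λ u → lookup S u ∧ adjᵇ G u v) (∈-allFin u) (∧-intro (∈⇒lookup u∈S) a))))

module _ {n} (G : Graph n) (B : Subset n) (a : Fin n) where

  ⊑-contract : ∀ {H} → H ⊑ G → (∀ {v} → v ∈ V H → v ∉ B - a) → H ⊑ contract G B a
  ⊑-contract {H} H⊑G outside = subgraph (λ v∈ → x∈p∧x∉q⇒x∈p─q (⊑-V H⊑G v∈) (outside v∈)) λ {u} {v} e →
    let u∈ , v∈ = Adj⇒∈V H {u} {v} e
    in Adjacent⇒Adj {G = contract G B a} (adjacent (x∈p∧x∉q⇒x∈p─q (⊑-V H⊑G u∈) (outside u∈))
         (x∈p∧x∉q⇒x∈p─q (⊑-V H⊑G v∈) (outside v∈)) (Adjacent.src≢tgt (Adj⇒Adjacent H {u} {v} e))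
         (inj₁ (∨-introˡ (⊑-Adj H⊑G e))))

  contract-Adj⁻ : ∀ {u v} → Adj (contract G B a) u v →
    Adj G u v ⊎ (u ≡ a × v ∈ nbhd G B) ⊎ (v ≡ a × u ∈ nbhd G B)
  contract-Adj⁻ {u} {v} e with Adjacent.edge (Adj⇒Adjacent (contract G B a) {u} {v} e)
  ... | inj₁ uv with ∨-elim {adjᵇ G u v} uv
  ...   | inj₁ old = inj₁ old
  ...   | inj₂ hub = inj₂ (inj₁ (does-true⇒≡ (∧-conicalˡ _ _ hub) , lookup⇒∈ (∧-conicalʳ ⌊ u ≟ a ⌋ _ hub)))
  contract-Adj⁻ {u} {v} e | inj₂ vu with ∨-elim {adjᵇ G v u} vu
  ...   | inj₁ old = inj₁ (Adj-sym G {v} {u} old)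
  ...   | inj₂ hub = inj₂ (inj₂ (does-true⇒≡ (∧-conicalˡ _ _ hub) , lookup⇒∈ (∧-conicalʳ ⌊ v ≟ a ⌋ _ hub)))

  contract-Adj-hub : ∀ {v} → a ∈ V (contract G B a) → v ∈ V (contract G B a) → a ≢ v → v ∈ nbhd G B →
    Adj (contract G B a) a v
  contract-Adj-hub a∈ v∈ a≢v v∈N = Adjacent⇒Adj {G = contract G B a}
    (adjacent a∈ v∈ a≢v (inj₁ (∨-introʳ {adjᵇ G a _} (∧-intro (≡⇒does-true refl) (∈⇒lookup v∈N)))))

addClique-Adj⁻ : ∀ {n} (G : Graph n) W {u v} → Adj (addClique G W) u v → Adj G u v ⊎ (u ∈ W × v ∈ W × u ≢ v)
addClique-Adj⁻ G W {u} {v} e with Adj⇒Adjacent (addClique G W) {u} {v} e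
... | adjacent u∈ v∈ u≢v (inj₁ uv) with ∨-elim {E G u v} uv
...   | inj₁ old = inj₁ (Adjacent⇒Adj {G = G} (adjacent u∈ v∈ u≢v (inj₁ old)))
...   | inj₂ new = inj₂ (lookup⇒∈ (∧-conicalˡ _ _ new) , lookup⇒∈ (∧-conicalʳ (lookup W u) _ new) , u≢v)
addClique-Adj⁻ G W {u} {v} e | adjacent u∈ v∈ u≢v (inj₂ vu) with ∨-elim {E G v u} vu
...   | inj₁ old = inj₁ (Adjacent⇒Adj {G = G} (adjacent u∈ v∈ u≢v (inj₂ old)))
...   | inj₂ new = inj₂ (lookup⇒∈ (∧-conicalʳ (lookup W v) _ new) , lookup⇒∈ (∧-conicalˡ _ _ new) , u≢v)

addClique-Adj⁺ : ∀ {n} (G : Graph n) W {u v} → u ∈ V G → v ∈ V G → u ∈ W → v ∈ W → u ≢ v → Adj (addClique G W) u v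
addClique-Adj⁺ G W u∈ v∈ u∈W v∈W u≢v = Adjacent⇒Adj {G = addClique G W}
  (adjacent u∈ v∈ u≢v (inj₁ (∨-introʳ {E G _ _} (∧-intro (∈⇒lookup u∈W) (∈⇒lookup v∈W)))))

addEdge-Adj : ∀ {n} (G : Graph n) {x y} → x ∈ V G → y ∈ V G → x ≢ y → Adj (addEdge G x y) x y
addEdge-Adj G {x} {y} x∈ y∈ x≢y = Adjacent⇒Adj {G = addEdge G x y}
  (adjacent x∈ y∈ x≢y (inj₁ (∨-introʳ {E G x y} (∧-intro (≡⇒does-true {u = x} refl) (≡⇒does-true {u = y} refl)))))

⊑-addEdge : ∀ {n} (G : Graph n) x y → G ⊑ addEdge G x y
⊑-addEdge G x y = subgraph (λ v∈ → v∈) λ {u} {v} e →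
  let adjacent u∈ v∈ u≢v uv = Adj⇒Adjacent G {u} {v} e
  in Adjacent⇒Adj {G = addEdge G x y} (adjacent u∈ v∈ u≢v (Sum.map ∨-introˡ ∨-introˡ uv))

addClique-⊑ : ∀ {n} {G K : Graph n} (W : Subset n) → G ⊑ K →
  (∀ {u v} → u ∈ W → v ∈ W → u ∈ V K → v ∈ V K → u ≢ v → Adj K u v) → addClique G W ⊑ K
addClique-⊑ {G = G} {K} W G⊑K W-clique = subgraph (⊑-V G⊑K) λ {u} {v} e →
  let u∈ , v∈ = Adj⇒∈V (addClique G W) {u} {v} e
  in [ ⊑-Adj G⊑K , (λ (u∈W , v∈W , u≢v) → W-clique u∈W v∈W (⊑-V G⊑K u∈) (⊑-V G⊑K v∈) u≢v) ]′
       (addClique-Adj⁻ G W {u} {v} e)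

⊑-addClique : ∀ {n} (G : Graph n) W → G ⊑ addClique G W
⊑-addClique G W = subgraph (λ v∈ → v∈) λ {u} {v} e →
  let adjacent u∈ v∈ u≢v uv = Adj⇒Adjacent G {u} {v} e
  in Adjacent⇒Adj {G = addClique G W} (adjacent u∈ v∈ u≢v (Sum.map ∨-introˡ ∨-introˡ uv))

ConnectedSet-unrestrict : ∀ {n} {G : Graph n} {C S} → S ⊆ C → ConnectedSet (induced G C) S → ConnectedSet G S
ConnectedSet-unrestrict {G = G} {C} {S} S⊆C connected u v u∈ v∈ =
  Reach-⊑ (⊑-induced (⊑-trans (induced-⊑ (induced G C) S) (induced-⊑ G C)) (proj₂ ∘ ∈∩⁻))
    (connected u v (restricted u∈) (restricted v∈))
  where
  restricted : ∀ {x} → x ∈ V G ∩ S → x ∈ (V G ∩ C) ∩ S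
  restricted x∈ = let x∈G , x∈S = ∈∩⁻ x∈ in ∈∩⁺ (∈∩⁺ x∈G (S⊆C x∈S)) x∈S

open TreeDecomposition

occurrences : ∀ {n m} → (Fin (suc m) → Subset n) → Fin n → Subset (suc m)
occurrences bag v = tabulate λ i → lookup (bag i) v

∈occurrences⁺ : ∀ {n m} (bag : Fin (suc m) → Subset n) {v i} → v ∈ bag i → i ∈ occurrences bag v
∈occurrences⁺ bag {v} = ∈-tabulate⁺ {f = λ i → lookup (bag i) v} ∘ ∈⇒lookup

∈occurrences⁻ : ∀ {n m} (bag : Fin (suc m) → Subset n) v {i} → i ∈ occurrences bag v → v ∈ bag i
∈occurrences⁻ bag v = lookup⇒∈ ∘ ∈-tabulate⁻ {f = λ i → lookup (bag i) v}

treeGraph-Adj⁻ : ∀ {m} (p : Fin m → Fin (suc m)) {i j} → Adj (treeGraph p) i j →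
  (∃ λ q → i ≡ suc q × p q ≡ j) ⊎ (∃ λ q → j ≡ suc q × p q ≡ i)
treeGraph-Adj⁻ p {i} {j} a =
  [ inj₂ ∘ child i j , inj₁ ∘ child j i ]′ (Adjacent.edge (Adj⇒Adjacent (treeGraph p) {i} {j} a))
  where
  child : ∀ i j → E (treeGraph p) i j ≡ true → ∃ λ q → j ≡ suc q × p q ≡ i
  child i (suc q) e = q , refl , does-true⇒≡ e

treeGraph-Adj⁺ : ∀ {m} (p : Fin m → Fin (suc m)) → (∀ q → toℕ (p q) ≤ toℕ q) →
  ∀ q → Adj (treeGraph p) (suc q) (p q)
treeGraph-Adj⁺ p p≤ q = Adjacent⇒Adj {G = treeGraph p}
  (adjacent ∈⊤ ∈⊤ (λ e → ℕ.<⇒≢ (s≤s (p≤ q)) (sym (cong toℕ e))) (inj₂ (≡⇒does-true refl)))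

treeGraph-Adj-map : ∀ {m m′} (p : Fin m → Fin (suc m)) (G : Graph m′) (φ : Fin (suc m) → Fin m′) →
  (∀ q → Adj G (φ (suc q)) (φ (p q))) → ∀ i j → Adj (treeGraph p) i j → Adj G (φ i) (φ j)
treeGraph-Adj-map p G φ φ-edge i j a with treeGraph-Adj⁻ p {i} {j} a
... | inj₁ (q , refl , refl) = φ-edge q
... | inj₂ (q , refl , refl) = Adj-sym G {φ (suc q)} {φ (p q)} (φ-edge q)

subtree⁺ : ∀ {m} {p : Fin m → Fin (suc m)} {S} →
  (∀ {i j} → i ∈ S → j ∈ S → Reach (induced (treeGraph p) S) i j) → ConnectedSet (treeGraph p) S
subtree⁺ reach _ _ i∈ j∈ = reach (proj₂ (∈∩⁻ i∈)) (proj₂ (∈∩⁻ j∈))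

subtree⁻ : ∀ {m} {p : Fin m → Fin (suc m)} {S} → ConnectedSet (treeGraph p) S →
  ∀ {i j} → i ∈ S → j ∈ S → Reach (induced (treeGraph p) S) i j
subtree⁻ conn i∈ j∈ = conn _ _ (∈∩⁺ ∈⊤ i∈) (∈∩⁺ ∈⊤ j∈)

Reach-subtree-map : ∀ {m m′} {p : Fin m → Fin (suc m)} {p′ : Fin m′ → Fin (suc m′)} {S S′}
  (φ : Fin (suc m) → Fin (suc m′)) →
  (∀ i j → Adj (treeGraph p) i j → Adj (treeGraph p′) (φ i) (φ j)) → (∀ {i} → i ∈ S → φ i ∈ S′) →
  ∀ {i j} → Reach (induced (treeGraph p) S) i j → Reach (induced (treeGraph p′) S′) (φ i) (φ j)
Reach-subtree-map {p = p} {p′} {S} {S′} φ φ-Adj φ-S = Reach-map φ (λ i∈ → ∈∩⁺ ∈⊤ (φ-S (proj₂ (∈∩⁻ i∈)))) λ {i} {j} a →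
  let i∈ , j∈ = Adj⇒∈V (induced (treeGraph p) S) {i} {j} a
  in induced-Adj⁺ (treeGraph p′) (φ-Adj i j (⊑-Adj (induced-⊑ (treeGraph p) S) a))
       (φ-S (proj₂ (∈∩⁻ i∈))) (φ-S (proj₂ (∈∩⁻ j∈)))

record Rerooting {n k} {G : Graph n} (D : TreeDecomposition k G) (r : Fin (suc (m D))) : Set where
  field
    decomposition : TreeDecomposition k G
    φ : Fin (suc (m D)) → Fin (suc (m decomposition))
    bag-φ : ∀ i → bag decomposition (φ i) ≡ bag D i
    φ-root : φ r ≡ zero
    Adj-φ : ∀ i j → Adj (treeGraph (parent D)) i j → Adj (treeGraph (parent decomposition)) (φ i) (φ j)

relabel : ∀ {n k} {G : Graph n} (D : TreeDecomposition k G) →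
  (p′ : Fin (m D) → Fin (suc (m D))) → (∀ i → toℕ (p′ i) ≤ toℕ i) →
  (ρ ρ⁻ : Fin (suc (m D)) → Fin (suc (m D))) → (∀ i → ρ⁻ (ρ i) ≡ i) → (∀ j → ρ (ρ⁻ j) ≡ j) →
  (∀ i j → Adj (treeGraph (parent D)) i j → Adj (treeGraph p′) (ρ i) (ρ j)) →
  TreeDecomposition k G
relabel D p′ p′≤ ρ ρ⁻ ρ⁻ρ ρρ⁻ ρ-Adj = record
  { m = m D
  ; parent = p′
  ; parent< = p′≤
  ; bag = bag D ∘ ρ⁻
  ; bag⊆V = bag⊆V D ∘ ρ⁻
  ; width = width D ∘ ρ⁻
  ; covers = λ v v∈ → let i , v∈i = covers D v v∈ in ρ i , back v∈i
  ; edges = λ u v a → let i , u∈i , v∈i = edges D u v a in ρ i , back u∈i , back v∈i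
  ; subtree = λ v → subtree⁺ λ {i} {j} i∈ j∈ → subst₂ (Reach _) (ρρ⁻ i) (ρρ⁻ j)
      (Reach-subtree-map ρ ρ-Adj (∈occurrences⁺ (bag D ∘ ρ⁻) ∘ back ∘ ∈occurrences⁻ (bag D) v)
        (subtree⁻ (subtree D v) (∈occurrences⁺ (bag D) (∈occurrences⁻ (bag D ∘ ρ⁻) v i∈))
                                (∈occurrences⁺ (bag D) (∈occurrences⁻ (bag D ∘ ρ⁻) v j∈))))
  }
  where
  back : ∀ {v i} → v ∈ bag D i → v ∈ bag D (ρ⁻ (ρ i))
  back {v} = subst (λ i → v ∈ bag D i) (sym (ρ⁻ρ _))

toℕ-punchIn : ∀ {n} (i : Fin (suc n)) (j : Fin n) →
  toℕ (punchIn i j) ≡ toℕ j ⊎ (toℕ i ≤ toℕ j × toℕ (punchIn i j) ≡ suc (toℕ j))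
toℕ-punchIn zero j = inj₂ (z≤n , refl)
toℕ-punchIn (suc i) zero = inj₁ refl
toℕ-punchIn (suc i) (suc j) = Sum.map (cong suc) (Product.map s≤s (cong suc)) (toℕ-punchIn i j)

toℕ-punchOut : ∀ {n} {i j : Fin (suc n)} (i≢j : i ≢ j) →
  suc (toℕ (punchOut i≢j)) ≡ toℕ j ⊎ (toℕ j < toℕ i × toℕ (punchOut i≢j) ≡ toℕ j)
toℕ-punchOut {_} {zero} {zero} i≢j = ⊥-elim (i≢j refl)
toℕ-punchOut {_} {zero} {suc j} _ = inj₁ refl
toℕ-punchOut {suc n} {suc i} {zero} _ = inj₂ (s≤s z≤n , refl)
toℕ-punchOut {suc n} {suc i} {suc j} i≢j =
  Sum.map (cong suc) (Product.map s≤s (cong suc)) (toℕ-punchOut (i≢j ∘ cong suc))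

-- A child r = suc c of the root becomes the root: r gets index 0 and the nodes of smaller index shift up
-- by one, so every parent still precedes its child.
module Rotation {n k} {G : Graph n} (D : TreeDecomposition k G) (c : Fin (m D)) (c-root : parent D c ≡ zero) where

  r : Fin (suc (m D))
  r = suc c

  ρ : Fin (suc (m D)) → Fin (suc (m D))
  ρ j with r ≟ j
  ... | yes _ = zero
  ... | no r≢j = suc (punchOut r≢j)

  ρ⁻ : Fin (suc (m D)) → Fin (suc (m D))
  ρ⁻ zero = r
  ρ⁻ (suc j) = punchIn r j

  ρ-root : ρ r ≡ zero
  ρ-root with r ≟ r
  ... | yes _ = refl
  ... | no r≢r = ⊥-elim (r≢r refl)

  ρ-other : ∀ {j} (r≢j : r ≢ j) → ρ j ≡ suc (punchOut r≢j)
  ρ-other {j} r≢j with r ≟ j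
  ... | yes r≡j = ⊥-elim (r≢j r≡j)
  ... | no _ = cong suc (Fin.punchOut-cong r refl)

  ρ⁻ρ : ∀ j → ρ⁻ (ρ j) ≡ j
  ρ⁻ρ j with r ≟ j
  ... | yes r≡j = r≡j
  ... | no r≢j = Fin.punchIn-punchOut r≢j

  ρρ⁻ : ∀ j → ρ (ρ⁻ j) ≡ j
  ρρ⁻ zero = ρ-root
  ρρ⁻ (suc j) = trans (ρ-other (Fin.punchInᵢ≢i r j ∘ sym)) (cong suc (Fin.punchOut-punchIn r))

  oldParent : Fin (suc (m D)) → Fin (suc (m D))
  oldParent zero = r
  oldParent (suc o) = parent D o

  parent′ : Fin (m D) → Fin (suc (m D))
  parent′ j = ρ (oldParent (punchIn r j))

  toℕ-ρ : ∀ y → toℕ (ρ y) ≤ suc (toℕ y) × toℕ (ρ y) ≤ toℕ y ⊔ toℕ r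
  toℕ-ρ y with r ≟ y
  ... | yes _ = z≤n , z≤n
  ... | no r≢y with toℕ-punchOut r≢y
  ...   | inj₁ above = ℕ.≤-trans (ℕ.≤-reflexive above) (ℕ.n≤1+n _) , ℕ.≤-trans (ℕ.≤-reflexive above) (ℕ.m≤m⊔n _ _)
  ...   | inj₂ (below , same) = s≤s (ℕ.≤-reflexive same) ,
          ℕ.≤-trans (subst (λ x → suc x ≤ toℕ r) (sym same) below) (ℕ.m≤n⊔m _ _)

  parent′≤ : ∀ j → toℕ (parent′ j) ≤ toℕ j
  parent′≤ j with punchIn r j | toℕ-punchIn r j
  ... | zero | _ = subst (_≤ toℕ j) (sym (cong toℕ ρ-root)) z≤n
  ... | suc o | inj₁ same =
          ℕ.≤-trans (proj₁ (toℕ-ρ (parent D o))) (ℕ.≤-trans (s≤s (parent< D o)) (ℕ.≤-reflexive same))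
  ... | suc o | inj₂ (r≤j , shifted) = ℕ.≤-trans (proj₂ (toℕ-ρ (parent D o)))
          (ℕ.⊔-lub (ℕ.≤-trans (parent< D o) (ℕ.≤-reflexive (ℕ.suc-injective shifted))) r≤j)

  Adj-oldParent : ∀ {j} → r ≢ j → Adj (treeGraph parent′) (ρ j) (ρ (oldParent j))
  Adj-oldParent r≢j = subst₂ (Adj (treeGraph parent′)) (sym (ρ-other r≢j))
    (cong (ρ ∘ oldParent) (Fin.punchIn-punchOut r≢j)) (treeGraph-Adj⁺ parent′ parent′≤ (punchOut r≢j))

  Adj-child : ∀ q → Adj (treeGraph parent′) (ρ (suc q)) (ρ (parent D q))
  Adj-child q = by-cases (r ≟ suc q)
    where
    by-cases : Dec (r ≡ suc q) → Adj (treeGraph parent′) (ρ (suc q)) (ρ (parent D q))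
    by-cases (no r≢q) = Adj-oldParent r≢q
    by-cases (yes refl) = subst₂ (Adj (treeGraph parent′)) (sym ρ-root) (cong ρ (sym c-root))
      (Adj-sym (treeGraph parent′) {ρ zero} {zero}
        (subst (Adj (treeGraph parent′) (ρ zero)) ρ-root (Adj-oldParent {zero} λ ())))

  ρ-Adj : ∀ i j → Adj (treeGraph (parent D)) i j → Adj (treeGraph parent′) (ρ i) (ρ j)
  ρ-Adj = treeGraph-Adj-map (parent D) (treeGraph parent′) ρ Adj-child

  rotated : Rerooting D r
  rotated = record
    { decomposition = relabel D parent′ parent′≤ ρ ρ⁻ ρ⁻ρ ρρ⁻ ρ-Adj
    ; φ = ρ
    ; bag-φ = cong (bag D) ∘ ρ⁻ρ
    ; φ-root = ρ-root
    ; Adj-φ = ρ-Adj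
    }

Rerooting-∘ : ∀ {n k} {G : Graph n} {D : TreeDecomposition k G} {r s} (R : Rerooting D s) →
  Rerooting (Rerooting.decomposition R) (Rerooting.φ R r) → Rerooting D r
Rerooting-∘ {D = D} R R′ = record
  { decomposition = R′.decomposition
  ; φ = R′.φ ∘ R.φ
  ; bag-φ = λ i → trans (R′.bag-φ (R.φ i)) (R.bag-φ i)
  ; φ-root = R′.φ-root
  ; Adj-φ = λ i j a → R′.Adj-φ (R.φ i) (R.φ j) (R.Adj-φ i j a)
  }
  where
  module R = Rerooting R
  module R′ = Rerooting R′

rerootWithin : ∀ {n k} {G : Graph n} (D : TreeDecomposition k G) r fuel → toℕ r < fuel → Rerooting D r
rerootWithin D zero _ _ = record
  { decomposition = D ; φ = λ i → i ; bag-φ = λ _ → refl ; φ-root = refl ; Adj-φ = λ _ _ a → a }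
rerootWithin D (suc j) (suc fuel) (s≤s j<fuel) = Rerooting-∘ R (rotate (treeGraph-Adj⁻ (parent D′) φj~root))
  where
  R : Rerooting D (parent D j)
  R = rerootWithin D (parent D j) fuel (ℕ.≤-<-trans (parent< D j) j<fuel)
  open Rerooting R using (φ) renaming (decomposition to D′)
  φj~root : Adj (treeGraph (parent D′)) (φ (suc j)) zero
  φj~root = subst (Adj (treeGraph (parent D′)) (φ (suc j))) (Rerooting.φ-root R)
    (Rerooting.Adj-φ R (suc j) (parent D j) (treeGraph-Adj⁺ (parent D) (parent< D) j))
  rotate : (∃ λ c → φ (suc j) ≡ suc c × parent D′ c ≡ zero) ⊎ (∃ λ c → zero ≡ suc c × parent D′ c ≡ φ (suc j)) →
    Rerooting D′ (φ (suc j))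
  rotate (inj₁ (c , φj≡c , c-root)) = subst (Rerooting D′) (sym φj≡c) (Rotation.rotated D′ c c-root)
  rotate (inj₂ (_ , () , _))

reroot : ∀ {n k} {G : Graph n} (D : TreeDecomposition k G) r → Rerooting D r
reroot D r = rerootWithin D r (suc (toℕ r)) ℕ.≤-refl

-- D₂ is hung below node i₁ of D₁: its root becomes a child of i₁.
module GlueAtRoot {n k} {G₁ G₂ : Graph n} (D₁ : TreeDecomposition k G₁) (D₂ : TreeDecomposition k G₂)
  (i₁ : Fin (suc (m D₁)))
  (interface : ∀ v → v ∈ V G₁ → v ∈ V G₂ → v ∈ bag D₁ i₁ × v ∈ bag D₂ zero) where

  m₁ m₂ : ℕ
  m₁ = m D₁
  m₂ = m D₂

  ι₁ : Fin (suc m₁) → Fin (suc (m₁ + suc m₂))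
  ι₁ i = i ↑ˡ suc m₂

  ι₂ : Fin (suc m₂) → Fin (suc (m₁ + suc m₂))
  ι₂ j = suc m₁ ↑ʳ j

  parent₂ : Fin (suc m₂) → Fin (suc (m₁ + suc m₂))
  parent₂ zero = ι₁ i₁
  parent₂ (suc j) = ι₂ (parent D₂ j)

  parent′ : Fin (m₁ + suc m₂) → Fin (suc (m₁ + suc m₂))
  parent′ i = [ ι₁ ∘ parent D₁ , parent₂ ]′ (splitAt m₁ i)

  parent′-ι₁ : ∀ i → parent′ (i ↑ˡ suc m₂) ≡ ι₁ (parent D₁ i)
  parent′-ι₁ i = cong [ ι₁ ∘ parent D₁ , parent₂ ]′ (Fin.splitAt-↑ˡ m₁ i (suc m₂))

  parent′-ι₂ : ∀ j → parent′ (m₁ ↑ʳ j) ≡ parent₂ j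
  parent′-ι₂ j = cong [ ι₁ ∘ parent D₁ , parent₂ ]′ (Fin.splitAt-↑ʳ m₁ (suc m₂) j)

  split : ∀ {a} b (i : Fin (a + b)) → (∃ λ i₁ → i ≡ i₁ ↑ˡ b) ⊎ (∃ λ i₂ → i ≡ a ↑ʳ i₂)
  split {a} b i with splitAt a i | Fin.join-splitAt a b i
  ... | inj₁ i₁ | eq = inj₁ (i₁ , sym eq)
  ... | inj₂ i₂ | eq = inj₂ (i₂ , sym eq)

  parent′≤ : ∀ i → toℕ (parent′ i) ≤ toℕ i
  parent′≤ i with split (suc m₂) i
  ... | inj₁ (i′ , refl) = subst₂ _≤_
          (sym (trans (cong toℕ (parent′-ι₁ i′)) (Fin.toℕ-↑ˡ (parent D₁ i′) (suc m₂))))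
          (sym (Fin.toℕ-↑ˡ i′ (suc m₂))) (parent< D₁ i′)
  ... | inj₂ (zero , refl) = subst₂ _≤_
          (sym (trans (cong toℕ (parent′-ι₂ zero)) (Fin.toℕ-↑ˡ i₁ (suc m₂))))
          (sym (trans (Fin.toℕ-↑ʳ m₁ (zero {m₂})) (ℕ.+-identityʳ m₁)))
          (Fin.toℕ≤pred[n] i₁)
  ... | inj₂ (suc j , refl) = subst₂ _≤_
          (sym (trans (cong toℕ (parent′-ι₂ (suc j))) (Fin.toℕ-↑ʳ (suc m₁) (parent D₂ j))))
          (sym (trans (Fin.toℕ-↑ʳ m₁ (suc j)) (ℕ.+-suc m₁ (toℕ j))))
          (ℕ.+-monoʳ-≤ (suc m₁) (parent< D₂ j))

  bag′ : Fin (suc (m₁ + suc m₂)) → Subset n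
  bag′ i = [ bag D₁ , bag D₂ ]′ (splitAt (suc m₁) i)

  bag′-ι₁ : ∀ i → bag′ (ι₁ i) ≡ bag D₁ i
  bag′-ι₁ i = cong [ bag D₁ , bag D₂ ]′ (Fin.splitAt-↑ˡ (suc m₁) i (suc m₂))

  bag′-ι₂ : ∀ j → bag′ (ι₂ j) ≡ bag D₂ j
  bag′-ι₂ j = cong [ bag D₁ , bag D₂ ]′ (Fin.splitAt-↑ʳ (suc m₁) (suc m₂) j)

  ∈bag′-ι₁ : ∀ {v i} → v ∈ bag D₁ i → v ∈ bag′ (ι₁ i)
  ∈bag′-ι₁ {v} = subst (v ∈_) (sym (bag′-ι₁ _))

  ∈bag′-ι₂ : ∀ {v j} → v ∈ bag D₂ j → v ∈ bag′ (ι₂ j)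
  ∈bag′-ι₂ {v} = subst (v ∈_) (sym (bag′-ι₂ _))

  T′ : Graph (suc (m₁ + suc m₂))
  T′ = treeGraph parent′

  ι₁-edge : ∀ q → Adj T′ (ι₁ (suc q)) (ι₁ (parent D₁ q))
  ι₁-edge q = subst (Adj T′ (ι₁ (suc q))) (parent′-ι₁ q) (treeGraph-Adj⁺ parent′ parent′≤ (q ↑ˡ suc m₂))

  ι₂-edge : ∀ q → Adj T′ (ι₂ (suc q)) (ι₂ (parent D₂ q))
  ι₂-edge q = subst (Adj T′ (ι₂ (suc q))) (parent′-ι₂ (suc q)) (treeGraph-Adj⁺ parent′ parent′≤ (m₁ ↑ʳ suc q))

  link : Adj T′ (ι₁ i₁) (ι₂ zero)
  link = Adj-sym T′ {ι₂ zero} {ι₁ i₁}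
    (subst (Adj T′ (ι₂ zero)) (parent′-ι₂ zero) (treeGraph-Adj⁺ parent′ parent′≤ (m₁ ↑ʳ zero)))

  module _ (v : Fin n) where

    S : Subset (suc (m₁ + suc m₂))
    S = occurrences bag′ v

    ι₁-S : ∀ {i} → i ∈ occurrences (bag D₁) v → ι₁ i ∈ S
    ι₁-S = ∈occurrences⁺ bag′ ∘ ∈bag′-ι₁ ∘ ∈occurrences⁻ (bag D₁) v

    ι₂-S : ∀ {j} → j ∈ occurrences (bag D₂) v → ι₂ j ∈ S
    ι₂-S = ∈occurrences⁺ bag′ ∘ ∈bag′-ι₂ ∘ ∈occurrences⁻ (bag D₂) v

    within₁ : ∀ {i j} → v ∈ bag D₁ i → v ∈ bag D₁ j → Reach (induced T′ S) (ι₁ i) (ι₁ j)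
    within₁ v∈i v∈j = Reach-subtree-map ι₁ (treeGraph-Adj-map (parent D₁) T′ ι₁ ι₁-edge) ι₁-S
      (subtree⁻ (subtree D₁ v) (∈occurrences⁺ (bag D₁) v∈i) (∈occurrences⁺ (bag D₁) v∈j))

    within₂ : ∀ {i j} → v ∈ bag D₂ i → v ∈ bag D₂ j → Reach (induced T′ S) (ι₂ i) (ι₂ j)
    within₂ v∈i v∈j = Reach-subtree-map ι₂ (treeGraph-Adj-map (parent D₂) T′ ι₂ ι₂-edge) ι₂-S
      (subtree⁻ (subtree D₂ v) (∈occurrences⁺ (bag D₂) v∈i) (∈occurrences⁺ (bag D₂) v∈j))

    across : ∀ {i j} → v ∈ bag D₁ i → v ∈ bag D₂ j → Reach (induced T′ S) (ι₁ i) (ι₂ j)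
    across {i} v∈i v∈j =
      let v∈i₁ , v∈root = interface v (bag⊆V D₁ i v∈i) (bag⊆V D₂ _ v∈j)
          link′ = induced-Adj⁺ T′ {S} {ι₁ i₁} {ι₂ zero} link
                    (ι₁-S (∈occurrences⁺ (bag D₁) v∈i₁)) (ι₂-S (∈occurrences⁺ (bag D₂) v∈root))
      in Reach-trans (within₁ v∈i v∈i₁) (step link′ (within₂ v∈root v∈j))

    Origin : Fin (suc (m₁ + suc m₂)) → Set
    Origin i = (∃ λ i₁ → i ≡ ι₁ i₁ × v ∈ bag D₁ i₁) ⊎ (∃ λ i₂ → i ≡ ι₂ i₂ × v ∈ bag D₂ i₂)

    node : ∀ {i} → i ∈ S → Origin i
    node {i} i∈ with split {suc m₁} (suc m₂) i
    ... | inj₁ (i₁ , refl) = inj₁ (i₁ , refl , subst (v ∈_) (bag′-ι₁ i₁) (∈occurrences⁻ bag′ v i∈))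
    ... | inj₂ (i₂ , refl) = inj₂ (i₂ , refl , subst (v ∈_) (bag′-ι₂ i₂) (∈occurrences⁻ bag′ v i∈))

    connected : ConnectedSet T′ S
    connected = subtree⁺ λ i∈ j∈ → reach (node i∈) (node j∈)
      where
      reach : ∀ {i j} → Origin i → Origin j → Reach (induced T′ S) i j
      reach (inj₁ (_ , refl , v∈i)) (inj₁ (_ , refl , v∈j)) = within₁ v∈i v∈j
      reach (inj₂ (_ , refl , v∈i)) (inj₂ (_ , refl , v∈j)) = within₂ v∈i v∈j
      reach (inj₁ (_ , refl , v∈i)) (inj₂ (_ , refl , v∈j)) = across v∈i v∈j
      reach (inj₂ (_ , refl , v∈i)) (inj₁ (_ , refl , v∈j)) = Reach-sym (across v∈j v∈i)

  bag′-cases : ∀ {ℓ} (P : Subset n → Set ℓ) → (∀ i → P (bag D₁ i)) → (∀ j → P (bag D₂ j)) → ∀ i → P (bag′ i)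
  bag′-cases P P₁ P₂ i with split {suc m₁} (suc m₂) i
  ... | inj₁ (i₁ , refl) = subst P (sym (bag′-ι₁ i₁)) (P₁ i₁)
  ... | inj₂ (i₂ , refl) = subst P (sym (bag′-ι₂ i₂)) (P₂ i₂)

  glued : TreeDecomposition k (G₁ ∪ᴳ G₂)
  glued = record
    { m = m₁ + suc m₂
    ; parent = parent′
    ; parent< = parent′≤
    ; bag = bag′
    ; bag⊆V = bag′-cases (_⊆ V G₁ ∪ V G₂) (λ i → x∈p∪q⁺ ∘ inj₁ ∘ bag⊆V D₁ i) (λ j → x∈p∪q⁺ ∘ inj₂ ∘ bag⊆V D₂ j)
    ; width = bag′-cases (λ b → ∣ b ∣ ≤ suc k) (width D₁) (width D₂)
    ; covers = λ v v∈ → [ cover₁ v , cover₂ v ]′ (x∈p∪q⁻ (V G₁) (V G₂) v∈)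
    ; edges = λ u v a → [ edge₁ u v , edge₂ u v ]′ (∪ᴳ-Adj⁻ G₁ G₂ {u} {v} a)
    ; subtree = connected
    }
    where
    cover₁ : ∀ v → v ∈ V G₁ → ∃ λ i → v ∈ bag′ i
    cover₁ v v∈ = let i , v∈i = covers D₁ v v∈ in ι₁ i , ∈bag′-ι₁ v∈i
    cover₂ : ∀ v → v ∈ V G₂ → ∃ λ i → v ∈ bag′ i
    cover₂ v v∈ = let i , v∈i = covers D₂ v v∈ in ι₂ i , ∈bag′-ι₂ v∈i
    edge₁ : ∀ u v → Adj G₁ u v → ∃ λ i → u ∈ bag′ i × v ∈ bag′ i
    edge₁ u v a = let i , u∈i , v∈i = edges D₁ u v a in ι₁ i , ∈bag′-ι₁ u∈i , ∈bag′-ι₁ v∈i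
    edge₂ : ∀ u v → Adj G₂ u v → ∃ λ i → u ∈ bag′ i × v ∈ bag′ i
    edge₂ u v a = let i , u∈i , v∈i = edges D₂ u v a in ι₂ i , ∈bag′-ι₂ u∈i , ∈bag′-ι₂ v∈i

glue : ∀ {n k} {G₁ G₂ : Graph n} (D₁ : TreeDecomposition k G₁) (D₂ : TreeDecomposition k G₂) i₁ i₂ →
  (∀ v → v ∈ V G₁ → v ∈ V G₂ → v ∈ bag D₁ i₁ × v ∈ bag D₂ i₂) → TreeDecomposition k (G₁ ∪ᴳ G₂)
glue D₁ D₂ i₁ i₂ interface = GlueAtRoot.glued D₁ R.decomposition i₁ λ v v∈₁ v∈₂ →
  let v∈i₁ , v∈i₂ = interface v v∈₁ v∈₂
  in v∈i₁ , subst (v ∈_) (trans (sym (R.bag-φ i₂)) (cong (bag R.decomposition) R.φ-root)) v∈i₂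
  where
  module R = Rerooting (reroot D₂ i₂)

restrict : ∀ {n k} {H K : Graph n} → H ⊑ K → TreeDecomposition k K → TreeDecomposition k H
restrict {H = H} H⊑K D = record
  { m = m D
  ; parent = parent D
  ; parent< = parent< D
  ; bag = bag′
  ; bag⊆V = λ _ → proj₁ ∘ ∈∩⁻
  ; width = λ i → ℕ.≤-trans (∣p∩q∣≤∣q∣ (V H) (bag D i)) (width D i)
  ; covers = λ v v∈ → let i , v∈i = covers D v (⊑-V H⊑K v∈) in i , ∈∩⁺ v∈ v∈i
  ; edges = λ u v a →
      let u∈ , v∈ = Adj⇒∈V H {u} {v} a
          i , u∈i , v∈i = edges D u v (⊑-Adj H⊑K a)
      in i , ∈∩⁺ u∈ u∈i , ∈∩⁺ v∈ v∈i
  ; subtree = λ v → subtree⁺ λ i∈ j∈ →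
      let v∈H , v∈i = ∈∩⁻ (∈occurrences⁻ bag′ v i∈)
          v∈j = proj₂ (∈∩⁻ (∈occurrences⁻ bag′ v j∈))
      in Reach-subtree-map (λ i → i) (λ _ _ a → a) (∈occurrences⁺ bag′ ∘ ∈∩⁺ v∈H ∘ ∈occurrences⁻ (bag D) v)
           (subtree⁻ (subtree D v) (∈occurrences⁺ (bag D) v∈i) (∈occurrences⁺ (bag D) v∈j))
  }
  where
  bag′ : Fin (suc (m D)) → Subset _
  bag′ i = V H ∩ bag D i

clique-in-bag : ∀ {n k} {G : Graph n} (D : TreeDecomposition k G) {Q : Subset n} → ∣ Q ∣ ≤ 2 → Q ⊆ V G →
  (∀ {u v} → u ∈ Q → v ∈ Q → u ≢ v → Adj G u v) → ∃ λ i → Q ⊆ bag D i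
clique-in-bag D {Q} ∣Q∣≤2 Q⊆V clique with nonempty? Q
... | no empty = zero , λ w∈Q → ⊥-elim (empty (_ , w∈Q))
... | yes (u , u∈Q) with nonempty? (Q - u)
...   | no only-u = let i , u∈i = covers D u (Q⊆V u∈Q) in i , λ w∈Q → subst (_∈ bag D i) (sym (≡u w∈Q)) u∈i
  where
  ≡u : ∀ {w} → w ∈ Q → w ≡ u
  ≡u {w} w∈Q with w ≟ u
  ... | yes w≡u = w≡u
  ... | no w≢u = ⊥-elim (only-u (w , x∈p∧x≢y⇒x∈p-y w∈Q w≢u))
...   | yes (v , v∈Q-u) =
  let v∈Q , v∉⁅u⁆ = x∈p─q⁻ v∈Q-u
      v≢u = x∉⁅y⁆⇒x≢y v∉⁅u⁆
      i , u∈i , v∈i = edges D u v (clique u∈Q v∈Q (v≢u ∘ sym))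
  in i , λ w∈Q → [ (λ w≡u → subst (_∈ bag D i) (sym w≡u) u∈i) , (λ w≡v → subst (_∈ bag D i) (sym w≡v) v∈i) ]′
                   (∣p∣≤2⇒≡⊎≡ ∣Q∣≤2 u∈Q v∈Q v≢u w∈Q)

-- H arises from K by contracting the connected set B into a ∈ B.  Each bag keeps its vertices outside B
-- and gets a instead of the ones inside B; the bags meeting B form a subtree since B is connected.
module Contraction {n k} {K H : Graph n} (D : TreeDecomposition k K) {B : Subset n} {a : Fin n}
  (a∈B : a ∈ B) (B⊆V : B ⊆ V K) (B-connected : ConnectedSet K B)
  (V⊆V : V H ⊆ V K) (V∩B : ∀ {v} → v ∈ V H → v ∈ B → v ≡ a)
  (lift : ∀ u v → Adj H u v →
     ∃ λ u′ → ∃ λ v′ → Adj K u′ v′ × (u′ ≡ u ⊎ (u ≡ a × u′ ∈ B)) × (v′ ≡ v ⊎ (v ≡ a × v′ ∈ B)))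
  where

  Preimage : Fin n → Fin n → Set
  Preimage v u = u ≡ v ⊎ (v ≡ a × u ∈ B)

  hub : Fin (suc (m D)) → Subset n
  hub i with nonempty? (bag D i ∩ B)
  ... | yes _ = ⁅ a ⁆
  ... | no _ = ⊥

  bag′ : Fin (suc (m D)) → Subset n
  bag′ i = V H ∩ ((bag D i ─ B) ∪ hub i)

  a∈hub : ∀ {i u} → u ∈ bag D i → u ∈ B → a ∈ hub i
  a∈hub {i} u∈i u∈B with nonempty? (bag D i ∩ B)
  ... | yes _ = x∈⁅x⁆ a
  ... | no none = ⊥-elim (none (_ , ∈∩⁺ u∈i u∈B))

  hub⁻ : ∀ {i v} → v ∈ hub i → v ≡ a × ∃ λ u → u ∈ bag D i × u ∈ B
  hub⁻ {i} v∈ with nonempty? (bag D i ∩ B)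
  ... | yes (u , u∈) = x∈⁅y⁆⇒x≡y a v∈ , u , ∈∩⁻ u∈
  ... | no _ = ⊥-elim (∉⊥ v∈)

  ∈bag′⁺ : ∀ {i v u} → v ∈ V H → u ∈ bag D i → Preimage v u → v ∈ bag′ i
  ∈bag′⁺ {v = v} v∈H u∈i (inj₁ refl) with v ∈? B
  ... | yes v∈B = ∈∩⁺ v∈H (x∈p∪q⁺ (inj₂ (subst (_∈ hub _) (sym (V∩B v∈H v∈B)) (a∈hub u∈i v∈B))))
  ... | no v∉B = ∈∩⁺ v∈H (x∈p∪q⁺ (inj₁ (x∈p∧x∉q⇒x∈p─q u∈i v∉B)))
  ∈bag′⁺ v∈H u∈i (inj₂ (refl , u∈B)) = ∈∩⁺ v∈H (x∈p∪q⁺ (inj₂ (a∈hub u∈i u∈B)))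

  ∈bag′⁻ : ∀ {i v} → v ∈ bag′ i → v ∈ V H × ∃ λ u → u ∈ bag D i × Preimage v u
  ∈bag′⁻ {i} {v} v∈ with ∈∩⁻ v∈
  ... | v∈H , v∈ʳ with x∈p∪q⁻ (bag D i ─ B) (hub i) v∈ʳ
  ...   | inj₁ v∈i─B = v∈H , v , proj₁ (x∈p─q⁻ v∈i─B) , inj₁ refl
  ...   | inj₂ v∈hub = let v≡a , u , u∈i , u∈B = hub⁻ v∈hub in v∈H , u , u∈i , inj₂ (v≡a , u∈B)

  width′ : ∀ i → ∣ bag′ i ∣ ≤ suc k
  width′ i = ℕ.≤-trans (∣p∩q∣≤∣q∣ (V H) _) (ℕ.≤-trans shrinks (width D i))
    where
    shrinks : ∣ (bag D i ─ B) ∪ hub i ∣ ≤ ∣ bag D i ∣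
    shrinks with nonempty? (bag D i ∩ B)
    ... | yes meets = ∣p─q∪⁅x⁆∣≤∣p∣ (bag D i) B a meets
    ... | no _ = p⊆q⇒∣p∣≤∣q∣ λ v∈ → [ proj₁ ∘ x∈p─q⁻ , ⊥-elim ∘ ∉⊥ ]′ (x∈p∪q⁻ (bag D i ─ B) ⊥ v∈)

  module Occurrences (v : Fin n) (v∈H : v ∈ V H) where

    S′ : Subset (suc (m D))
    S′ = occurrences bag′ v

    T : Graph (suc (m D))
    T = treeGraph (parent D)

    through : ∀ {u} → Preimage v u → ∀ {i j} → u ∈ bag D i → u ∈ bag D j → Reach (induced T S′) i j
    through {u} u↦v u∈i u∈j = Reach-subtree-map (λ i → i) (λ _ _ e → e)
      (λ l∈ → ∈occurrences⁺ bag′ (∈bag′⁺ v∈H (∈occurrences⁻ (bag D) u l∈) u↦v))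
      (subtree⁻ (subtree D u) (∈occurrences⁺ (bag D) u∈i) (∈occurrences⁺ (bag D) u∈j))

    along : v ≡ a → ∀ {u u′} → Reach (induced K B) u u′ →
      ∀ {i j} → u ∈ bag D i → u′ ∈ bag D j → Reach (induced T S′) i j
    along v≡a (here u∈) u∈i u∈j = through (inj₂ (v≡a , proj₂ (∈∩⁻ u∈))) u∈i u∈j
    along v≡a (step {u} {w} e r) u∈i u′∈j =
      let u∈B = proj₂ (∈∩⁻ (proj₁ (Adj⇒∈V (induced K B) {u} {w} e)))
          l , u∈l , w∈l = edges D u w (⊑-Adj (induced-⊑ K B) e)
      in Reach-trans (through (inj₂ (v≡a , u∈B)) u∈i u∈l) (along v≡a r w∈l u′∈j)

    across-B : v ≡ a → ∀ {u u′ i j} → Preimage v u → Preimage v u′ → u ∈ bag D i → u′ ∈ bag D j →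
      Reach (induced T S′) i j
    across-B v≡a u↦v u′↦v u∈i u′∈j =
      along v≡a (B-connected _ _ (∈∩⁺ (B⊆V (inB u↦v)) (inB u↦v)) (∈∩⁺ (B⊆V (inB u′↦v)) (inB u′↦v))) u∈i u′∈j
      where
      inB : ∀ {u} → Preimage v u → u ∈ B
      inB (inj₁ refl) = subst (_∈ B) (sym v≡a) a∈B
      inB (inj₂ (_ , u∈B)) = u∈B

    connected : ∀ {i j} → i ∈ S′ → j ∈ S′ → Reach (induced T S′) i j
    connected i∈ j∈ with ∈bag′⁻ (∈occurrences⁻ bag′ v i∈) | ∈bag′⁻ (∈occurrences⁻ bag′ v j∈)
    ... | _ , _ , u∈i , inj₁ refl | _ , _ , u′∈j , inj₁ refl = through (inj₁ refl) u∈i u′∈j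
    ... | _ , _ , u∈i , u↦v@(inj₂ (v≡a , _)) | _ , _ , u′∈j , u′↦v = across-B v≡a u↦v u′↦v u∈i u′∈j
    ... | _ , _ , u∈i , u↦v | _ , _ , u′∈j , u′↦v@(inj₂ (v≡a , _)) = across-B v≡a u↦v u′↦v u∈i u′∈j

  contracted : TreeDecomposition k H
  contracted = record
    { m = m D
    ; parent = parent D
    ; parent< = parent< D
    ; bag = bag′
    ; bag⊆V = λ _ → proj₁ ∘ ∈∩⁻
    ; width = width′
    ; covers = λ v v∈ → let i , v∈i = covers D v (V⊆V v∈) in i , ∈bag′⁺ v∈ v∈i (inj₁ refl)
    ; edges = λ u v e →
        let u′ , v′ , e′ , u′↦u , v′↦v = lift u v e
            u∈ , v∈ = Adj⇒∈V H {u} {v} e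
            i , u′∈i , v′∈i = edges D u′ v′ e′
        in i , ∈bag′⁺ u∈ u′∈i u′↦u , ∈bag′⁺ v∈ v′∈i v′↦v
    ; subtree = λ v → subtree⁺ λ i∈ j∈ → Occurrences.connected v (proj₁ (∈bag′⁻ (∈occurrences⁻ bag′ v i∈))) i∈ j∈
    }

module SafeContraction {n} (G : Graph n) (t : ℕ) {B : Subset n} {a : Fin n}
  (a∈B : a ∈ B) (B⊆V : B ⊆ V G) (B-connected : ConnectedSet G B) (tw-B : TW≤ 2 (induced G B))
  (limit : Limit1 (delete G B) t (nbhd G (B - a) - a))
  (tw-B+x : ∀ x → x ∈ nbhd G (B - a) - a → TW≤ 2 (addEdge (induced G (B ∪ ⁅ x ⁆)) a x)) where

  G′ : Graph n
  G′ = contract G B a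

  W : Subset n
  W = nbhd G (B - a) - a

  a∈G′ : a ∈ V G′
  a∈G′ = x∈p∧x∉q⇒x∈p─q (B⊆V a∈B) λ a∈B-a → x∉⁅y⁆⇒x≢y (proj₂ (x∈p─q⁻ a∈B-a)) refl

  ∉B-a⇒≡a : ∀ {v} → v ∈ B → v ∉ B - a → v ≡ a
  ∉B-a⇒≡a {v} v∈B v∉ with v ≟ a
  ... | yes v≡a = v≡a
  ... | no v≢a = ⊥-elim (v∉ (x∈p∧x≢y⇒x∈p-y v∈B v≢a))

  ∉B-a⇒∉B : ∀ {v} → v ∉ B - a → v ≢ a → v ∉ B
  ∉B-a⇒∉B v∉ v≢a v∈B = v≢a (∉B-a⇒≡a v∈B v∉)

  ∉B⇒∉B-a : ∀ {v} → v ∉ B → v ∉ B - a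
  ∉B⇒∉B-a v∉B = v∉B ∘ proj₁ ∘ x∈p─q⁻

  ∉B⇒≢a : ∀ {v} → v ∉ B → v ≢ a
  ∉B⇒≢a v∉B refl = v∉B a∈B

  G′-∈⁻ : ∀ {v} → v ∈ V G′ → v ∈ V G × v ∉ B - a
  G′-∈⁻ = x∈p─q⁻

  G′-∈⁺ : ∀ {v} → v ∈ V G → v ∉ B - a → v ∈ V G′
  G′-∈⁺ = x∈p∧x∉q⇒x∈p─q

  hub-modulator : ∀ {Y} → IsModulator G Y → IsModulator G′ ((Y ─ B) ∪ ⁅ a ⁆)
  hub-modulator {Y} (Y⊆V , tw) = Y′⊆V , restrict (subgraph V⊆V Adj⊆Adj) tw
    where
    Y′ : Subset n
    Y′ = (Y ─ B) ∪ ⁅ a ⁆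

    Y′⊆V : Y′ ⊆ V G′
    Y′⊆V v∈ with x∈p∪q⁻ (Y ─ B) ⁅ a ⁆ v∈
    ... | inj₁ v∈Y─B = let v∈Y , v∉B = x∈p─q⁻ v∈Y─B in G′-∈⁺ (Y⊆V v∈Y) (∉B⇒∉B-a v∉B)
    ... | inj₂ v∈⁅a⁆ = subst (_∈ V G′) (sym (x∈⁅y⁆⇒x≡y a v∈⁅a⁆)) a∈G′

    remaining : ∀ {v} → v ∈ V (delete G′ Y′) → v ∈ V G × v ∉ Y × v ≢ a
    remaining v∈ =
      let v∈G′ , v∉Y′ = ∈∩∁⁻ v∈
          v∈G , v∉B-a = G′-∈⁻ v∈G′
          v≢a = λ v≡a → v∉Y′ (x∈p∪q⁺ (inj₂ (subst (_∈ ⁅ a ⁆) (sym v≡a) (x∈⁅x⁆ a))))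
          v∉B = ∉B-a⇒∉B v∉B-a v≢a
      in v∈G , (λ v∈Y → v∉Y′ (x∈p∪q⁺ (inj₁ (x∈p∧x∉q⇒x∈p─q v∈Y v∉B)))) , v≢a

    V⊆V : V (delete G′ Y′) ⊆ V (delete G Y)
    V⊆V v∈ = let v∈G , v∉Y , _ = remaining v∈ in ∈∩∁⁺ v∈G v∉Y

    Adj⊆Adj : ∀ {u v} → Adj (delete G′ Y′) u v → Adj (delete G Y) u v
    Adj⊆Adj {u} {v} e with Adj⇒∈V (delete G′ Y′) {u} {v} e
    ... | u∈ , v∈ with remaining u∈ | remaining v∈ | contract-Adj⁻ G B a (⊑-Adj (induced-⊑ G′ (∁ Y′)) e)
    ...   | _ , u∉Y , _ | _ , v∉Y , _ | inj₁ old = induced-Adj⁺ G old (x∉p⇒x∈∁p u∉Y) (x∉p⇒x∈∁p v∉Y)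
    ...   | _ , _ , u≢a | _ | inj₂ (inj₁ (u≡a , _)) = ⊥-elim (u≢a u≡a)
    ...   | _ | _ , _ , v≢a | inj₂ (inj₂ (v≡a , _)) = ⊥-elim (v≢a v≡a)

  contracted-modulator : ∀ {Y} → IsModulator G Y → ¬ Nonempty (Y ∩ B) → IsModulator G′ Y
  contracted-modulator {Y} (Y⊆V , tw) avoids = Y⊆V′ , Contraction.contracted tw a∈B B⊆V-Y B-connected-Y V⊆V V∩B lift
    where
    ∉Y : ∀ {v} → v ∈ B → v ∉ Y
    ∉Y v∈B v∈Y = avoids (_ , ∈∩⁺ v∈Y v∈B)

    Y⊆V′ : Y ⊆ V G′
    Y⊆V′ v∈Y = G′-∈⁺ (Y⊆V v∈Y) (∉B⇒∉B-a λ v∈B → ∉Y v∈B v∈Y)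

    B⊆V-Y : B ⊆ V (delete G Y)
    B⊆V-Y v∈B = ∈∩∁⁺ (B⊆V v∈B) (∉Y v∈B)

    B-connected-Y : ConnectedSet (delete G Y) B
    B-connected-Y u v u∈ v∈ =
      let u∈B = proj₂ (∈∩⁻ u∈) ; v∈B = proj₂ (∈∩⁻ v∈)
      in Reach-⊑ (⊑-induced (⊑-delete (induced-⊑ G B) (∉Y ∘ proj₂ ∘ ∈∩⁻)) (proj₂ ∘ ∈∩⁻))
           (B-connected u v (∈∩⁺ (B⊆V u∈B) u∈B) (∈∩⁺ (B⊆V v∈B) v∈B))

    V⊆V : V (delete G′ Y) ⊆ V (delete G Y)
    V⊆V v∈ = let v∈G′ , v∉Y = ∈∩∁⁻ v∈ in ∈∩∁⁺ (proj₁ (G′-∈⁻ v∈G′)) v∉Y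

    V∩B : ∀ {v} → v ∈ V (delete G′ Y) → v ∈ B → v ≡ a
    V∩B v∈ v∈B = ∉B-a⇒≡a v∈B (proj₂ (G′-∈⁻ (proj₁ (∈∩∁⁻ v∈))))

    lift : ∀ u v → Adj (delete G′ Y) u v → ∃ λ u′ → ∃ λ v′ → Adj (delete G Y) u′ v′ ×
      (u′ ≡ u ⊎ (u ≡ a × u′ ∈ B)) × (v′ ≡ v ⊎ (v ≡ a × v′ ∈ B))
    lift u v e with Adj⇒∈V (delete G′ Y) {u} {v} e | contract-Adj⁻ G B a (⊑-Adj (induced-⊑ G′ (∁ Y)) e)
    ... | u∈ , v∈ | inj₁ old = u , v , induced-Adj⁺ G old (proj₂ (∈∩⁻ (V⊆V u∈))) (proj₂ (∈∩⁻ (V⊆V v∈))) ,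
                                inj₁ refl , inj₁ refl
    ... | u∈ , v∈ | inj₂ (inj₁ (u≡a , v∈N)) =
      let _ , b , b∈B , b~v = nbhd⁻ G B v∈N
      in b , v , induced-Adj⁺ G b~v (proj₂ (∈∩⁻ (B⊆V-Y b∈B))) (proj₂ (∈∩⁻ (V⊆V v∈))) , inj₂ (u≡a , b∈B) , inj₁ refl
    ... | u∈ , v∈ | inj₂ (inj₂ (v≡a , u∈N)) =
      let _ , b , b∈B , b~u = nbhd⁻ G B u∈N
      in u , b , induced-Adj⁺ G (Adj-sym G {b} {u} b~u) (proj₂ (∈∩⁻ (V⊆V u∈))) (proj₂ (∈∩⁻ (B⊆V-Y b∈B))) ,
         inj₁ refl , inj₂ (v≡a , b∈B)

  forward : TW2D≤ G t → TW2D≤ G′ t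
  forward (Y , modulator , ∣Y∣≤t) with nonempty? (Y ∩ B)
  ... | yes meets = (Y ─ B) ∪ ⁅ a ⁆ , hub-modulator modulator , ℕ.≤-trans (∣p─q∪⁅x⁆∣≤∣p∣ Y B a meets) ∣Y∣≤t
  ... | no avoids = Y , contracted-modulator modulator avoids , ∣Y∣≤t

  W⁻ : ∀ {z} → z ∈ W → z ∈ V G × z ∉ B × z ∈ nbhd G B
  W⁻ z∈W =
    let z∈N , z∉⁅a⁆ = x∈p─q⁻ z∈W
        z∉B-a , u , u∈B-a , u~z = nbhd⁻ G (B - a) z∈N
        z∉B = ∉B-a⇒∉B z∉B-a (x∉⁅y⁆⇒x≢y z∉⁅a⁆)
    in proj₂ (Adj⇒∈V G u~z) , z∉B , nbhd⁺ G B z∉B (proj₁ (x∈p─q⁻ u∈B-a)) u~z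

  module Lifting {Y : Subset n} (Y⊆V : Y ⊆ V G′) (tw-G′-Y : TW≤ 2 (delete G′ Y)) (∣Y∣≤t : ∣ Y ∣ ≤ t) where

    S₀ Z Q : Subset n
    S₀ = Y - a
    Z = W ─ S₀
    Q = ⁅ a ⁆ ∪ Z

    G₁ G₂ : Graph n
    G₁ = delete G′ Y
    G₂ = addClique (induced G (B ∪ Z)) Q

    S₀-solution : IsSolution (delete G B) t S₀
    S₀-solution = S₀⊆V , ℕ.≤-trans (∣p─q∣≤∣p∣ Y ⁅ a ⁆) ∣Y∣≤t , restrict (⊑-delete G-B-S₀⊑G′ ∉Y) tw-G′-Y
      where
      S₀⊆V : S₀ ⊆ V (delete G B)
      S₀⊆V v∈S₀ =
        let v∈Y , v∉⁅a⁆ = x∈p─q⁻ v∈S₀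
            v∈G , v∉B-a = G′-∈⁻ (Y⊆V v∈Y)
        in ∈∩∁⁺ v∈G (∉B-a⇒∉B v∉B-a (x∉⁅y⁆⇒x≢y v∉⁅a⁆))
      G-B-S₀⊑G′ : delete (delete G B) S₀ ⊑ G′
      G-B-S₀⊑G′ = ⊑-contract G B a (⊑-trans (induced-⊑ (delete G B) (∁ S₀)) (induced-⊑ G (∁ B)))
        (∉B⇒∉B-a ∘ proj₂ ∘ ∈∩∁⁻ ∘ proj₁ ∘ ∈∩∁⁻)
      ∉Y : ∀ {v} → v ∈ V (delete (delete G B) S₀) → v ∉ Y
      ∉Y v∈ v∈Y = let v∈G-B , v∉S₀ = ∈∩∁⁻ v∈
                  in v∉S₀ (x∈p∧x≢y⇒x∈p-y v∈Y (∉B⇒≢a (proj₂ (∈∩∁⁻ v∈G-B))))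

    ∣Z∣≤1 : ∣ Z ∣ ≤ 1
    ∣Z∣≤1 = limit S₀ S₀-solution

    ∣Q∣≤2 : ∣ Q ∣ ≤ 2
    ∣Q∣≤2 = ℕ.≤-trans (∣p∪q∣≤∣p∣+∣q∣ ⁅ a ⁆ Z) (subst (_≤ 2) (sym (cong (_+ ∣ Z ∣) (∣⁅x⁆∣≡1 a))) (s≤s ∣Z∣≤1))

    Z⁻ : ∀ {z} → z ∈ Z → z ∈ V G × z ∉ B × z ∈ nbhd G B
    Z⁻ = W⁻ ∘ proj₁ ∘ x∈p─q⁻

    Q-pair : ∀ {u v} → u ∈ Q → v ∈ Q → u ≢ v → (u ≡ a × v ∈ Z) ⊎ (v ≡ a × u ∈ Z)
    Q-pair {u} {v} u∈Q v∈Q u≢v with x∈p∪q⁻ ⁅ a ⁆ Z u∈Q | x∈p∪q⁻ ⁅ a ⁆ Z v∈Q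
    ... | inj₁ u∈⁅a⁆ | inj₁ v∈⁅a⁆ = ⊥-elim (u≢v (trans (x∈⁅y⁆⇒x≡y a u∈⁅a⁆) (sym (x∈⁅y⁆⇒x≡y a v∈⁅a⁆))))
    ... | inj₁ u∈⁅a⁆ | inj₂ v∈Z = inj₁ (x∈⁅y⁆⇒x≡y a u∈⁅a⁆ , v∈Z)
    ... | inj₂ u∈Z | inj₁ v∈⁅a⁆ = inj₂ (x∈⁅y⁆⇒x≡y a v∈⁅a⁆ , u∈Z)
    ... | inj₂ u∈Z | inj₂ v∈Z = ⊥-elim (u≢v (∣p∣≤1⇒≡ ∣Z∣≤1 v∈Z u∈Z))

    Q-clique : ∀ (K : Graph n) → (∀ {z} → z ∈ Z → a ∈ V K → z ∈ V K → Adj K a z) →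
      ∀ {u v} → u ∈ Q → v ∈ Q → u ∈ V K → v ∈ V K → u ≢ v → Adj K u v
    Q-clique K a~Z u∈Q v∈Q u∈ v∈ u≢v with Q-pair u∈Q v∈Q u≢v
    ... | inj₁ (refl , v∈Z) = a~Z v∈Z u∈ v∈
    ... | inj₂ (refl , u∈Z) = Adj-sym K (a~Z u∈Z v∈ u∈)

    tw-G₂ : TW≤ 2 G₂
    tw-G₂ with nonempty? Z
    ... | no empty = restrict (addClique-⊑ Q (⊑-induced (induced-⊑ G (B ∪ Z)) in-B)
                       (Q-clique (induced G B) λ z∈Z → ⊥-elim (empty (_ , z∈Z)))) tw-B
      where
      in-B : V (induced G (B ∪ Z)) ⊆ B
      in-B v∈ = [ (λ v∈B → v∈B) , (λ v∈Z → ⊥-elim (empty (_ , v∈Z))) ]′ (x∈p∪q⁻ B Z (proj₂ (∈∩⁻ v∈)))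
    ... | yes (x , x∈Z) = restrict (addClique-⊑ Q (⊑-trans inner⊑ (⊑-addEdge K a x)) (Q-clique (addEdge K a x) a~x))
                            (tw-B+x x (proj₁ (x∈p─q⁻ x∈Z)))
      where
      K : Graph n
      K = induced G (B ∪ ⁅ x ⁆)
      inner⊑ : induced G (B ∪ Z) ⊑ K
      inner⊑ = ⊑-induced (induced-⊑ G (B ∪ Z)) λ v∈ →
        [ x∈p∪q⁺ ∘ inj₁ , (λ v∈Z → x∈p∪q⁺ (inj₂ (subst (_∈ ⁅ x ⁆) (sym (∣p∣≤1⇒≡ ∣Z∣≤1 x∈Z v∈Z)) (x∈⁅x⁆ x)))) ]′
          (x∈p∪q⁻ B Z (proj₂ (∈∩⁻ v∈)))
      a~x : ∀ {z} → z ∈ Z → a ∈ V (addEdge K a x) → z ∈ V (addEdge K a x) → Adj (addEdge K a x) a z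
      a~x z∈Z a∈ z∈ with ∣p∣≤1⇒≡ ∣Z∣≤1 x∈Z z∈Z
      ... | refl = addEdge-Adj K a∈ z∈ (∉B⇒≢a (proj₁ (proj₂ (Z⁻ z∈Z))) ∘ sym)

    toward-B : ∀ {u v} → Adj (delete G Y) u v → u ∈ B - a → Adj G₂ u v
    toward-B {u} {v} e u∈B-a =
      ⊑-Adj (⊑-addClique (induced G (B ∪ Z)) Q) (induced-Adj⁺ G e′ (x∈p∪q⁺ (inj₁ (proj₁ (x∈p─q⁻ u∈B-a)))) v∈B∪Z)
      where
      e′ : Adj G u v
      e′ = ⊑-Adj (induced-⊑ G (∁ Y)) e
      v∉Y : v ∉ Y
      v∉Y = proj₂ (∈∩∁⁻ (proj₂ (Adj⇒∈V (delete G Y) {u} {v} e)))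
      v∈B∪Z : v ∈ B ∪ Z
      v∈B∪Z with v ∈? B
      ... | yes v∈B = x∈p∪q⁺ (inj₁ v∈B)
      ... | no v∉B = x∈p∪q⁺ (inj₂ (x∈p∧x∉q⇒x∈p─q
              (x∈p∧x≢y⇒x∈p-y (nbhd⁺ G (B - a) (∉B⇒∉B-a v∉B) u∈B-a e′) (∉B⇒≢a v∉B))
              (v∉Y ∘ proj₁ ∘ x∈p─q⁻)))

    away-from-B : delete (delete G Y) (B - a) ⊑ G₁
    away-from-B = ⊑-delete (⊑-contract G B a (⊑-trans (induced-⊑ (delete G Y) _) (induced-⊑ G (∁ Y)))
                              (proj₂ ∘ ∈∩∁⁻))
                            (proj₂ ∘ ∈∩∁⁻ ∘ proj₁ ∘ ∈∩∁⁻)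

    cover : delete G Y ⊑ G₁ ∪ᴳ G₂
    cover = ⊑-∪ᴳ {H = delete G Y} {G₁} {G₂} cover-V cover-Adj
      where
      cover-V : ∀ {v} → v ∈ V (delete G Y) → v ∈ V G₁ ⊎ v ∈ V G₂
      cover-V {v} v∈ with v ∈? (B - a)
      ... | yes v∈B-a = inj₂ (∈∩⁺ (proj₁ (∈∩∁⁻ v∈)) (x∈p∪q⁺ (inj₁ (proj₁ (x∈p─q⁻ v∈B-a)))))
      ... | no v∉B-a = inj₁ (⊑-V away-from-B (∈∩∁⁺ v∈ v∉B-a))
      cover-Adj : ∀ u v → Adj (delete G Y) u v → Adj G₁ u v ⊎ Adj G₂ u v
      cover-Adj u v e with u ∈? (B - a) | v ∈? (B - a)
      ... | yes u∈B-a | _ = inj₂ (toward-B e u∈B-a)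
      ... | no _ | yes v∈B-a = inj₂ (Adj-sym G₂ {v} {u} (toward-B (Adj-sym (delete G Y) {u} {v} e) v∈B-a))
      ... | no u∉B-a | no v∉B-a =
        inj₁ (⊑-Adj away-from-B (induced-Adj⁺ (delete G Y) e (x∉p⇒x∈∁p u∉B-a) (x∉p⇒x∈∁p v∉B-a)))

    interface-Q : ∀ {v} → v ∈ V G₁ → v ∈ V G₂ → v ∈ Q
    interface-Q v∈₁ v∈₂ with x∈p∪q⁻ B Z (proj₂ (∈∩⁻ v∈₂))
    ... | inj₁ v∈B = x∈p∪q⁺ (inj₁ (subst (_∈ ⁅ a ⁆) (sym (∉B-a⇒≡a v∈B (proj₂ (G′-∈⁻ (proj₁ (∈∩∁⁻ v∈₁)))))) (x∈⁅x⁆ a)))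
    ... | inj₂ v∈Z = x∈p∪q⁺ (inj₂ v∈Z)

    Q-bag : ∀ {K} (D : TW≤ 2 K) → (∀ {z} → z ∈ Z → a ∈ V K → z ∈ V K → Adj K a z) → ∃ λ i → Q ∩ V K ⊆ bag D i
    Q-bag {K} D a~Z = clique-in-bag D (ℕ.≤-trans (∣p∩q∣≤∣p∣ Q (V K)) ∣Q∣≤2) (proj₂ ∘ ∈∩⁻) λ u∈ v∈ →
      let u∈Q , u∈K = ∈∩⁻ u∈ ; v∈Q , v∈K = ∈∩⁻ v∈ in Q-clique K a~Z u∈Q v∈Q u∈K v∈K

    bag₁ : ∃ λ i → Q ∩ V G₁ ⊆ bag tw-G′-Y i
    bag₁ = Q-bag tw-G′-Y λ z∈Z a∈ z∈ →
      let a∈G′ , a∉Y = ∈∩∁⁻ a∈ ; z∈G′ , z∉Y = ∈∩∁⁻ z∈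
          _ , z∉B , z∈N = Z⁻ z∈Z
      in induced-Adj⁺ G′ (contract-Adj-hub G B a a∈G′ z∈G′ (∉B⇒≢a z∉B ∘ sym) z∈N) (x∉p⇒x∈∁p a∉Y) (x∉p⇒x∈∁p z∉Y)

    bag₂ : ∃ λ i → Q ∩ V G₂ ⊆ bag tw-G₂ i
    bag₂ = Q-bag tw-G₂ λ z∈Z a∈ z∈ →
      addClique-Adj⁺ (induced G (B ∪ Z)) Q a∈ z∈ (x∈p∪q⁺ (inj₁ (x∈⁅x⁆ a))) (x∈p∪q⁺ (inj₂ z∈Z))
        (∉B⇒≢a (proj₁ (proj₂ (Z⁻ z∈Z))) ∘ sym)

    tw-G-Y : TW≤ 2 (delete G Y)
    tw-G-Y = restrict cover (glue {G₁ = G₁} {G₂} tw-G′-Y tw-G₂ (proj₁ bag₁) (proj₁ bag₂) λ v v∈₁ v∈₂ →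
      proj₂ bag₁ (∈∩⁺ (interface-Q v∈₁ v∈₂) v∈₁) , proj₂ bag₂ (∈∩⁺ (interface-Q v∈₁ v∈₂) v∈₂))

  backward : TW2D≤ G′ t → TW2D≤ G t
  backward (Y , (Y⊆V , tw) , ∣Y∣≤t) = Y , (proj₁ ∘ G′-∈⁻ ∘ Y⊆V , Lifting.tw-G-Y Y⊆V tw ∣Y∣≤t) , ∣Y∣≤t

lemma7p9 : ∀ {n} (G : Graph n) (t : ℕ) (X C B : Subset n) (a : Fin n) →
    NonTrivial G t →
    IsModulator G X →
    IsComponent (delete G X) C →
    IsBlock (induced G C) B →
    OnlyNeighbour (induced G C) B a →
    Limit1 (delete G B) t (nbhd G (B - a) - a) →
    (∀ x → x ∈ (nbhd G (B - a) - a) →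
      TW≤ 2 (addEdge (induced G (B ∪ ⁅ x ⁆)) a x)) →
    TW2D≤ G t ⇔ TW2D≤ (contract G B a) t
lemma7p9 G t X C B a _ (_ , tw-G-X) component block only-neighbour limit tw-B+x = mk⇔ forward backward
  where
  B⊆G-X : B ⊆ V (delete G X)
  B⊆G-X = proj₁ component ∘ proj₂ ∘ ∈∩⁻ ∘ proj₁ block

  B-connected : ConnectedSet G B
  B-connected = ConnectedSet-unrestrict (proj₂ ∘ ∈∩⁻ ∘ proj₁ block) (proj₁ (proj₁ (proj₂ (proj₂ block))))

  tw-B : TW≤ 2 (induced G B)
  tw-B = restrict (⊑-delete (induced-⊑ G B) (proj₂ ∘ ∈∩∁⁻ ∘ B⊆G-X ∘ proj₂ ∘ ∈∩⁻)) tw-G-X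

  open SafeContraction G t (proj₂ (proj₁ only-neighbour)) (proj₁ ∘ ∈∩⁻ ∘ B⊆G-X) B-connected tw-B limit tw-B+x
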